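{- Let $t$ be a positive integer. If a graph $G$ has a circular drawing whose crossing graph has no $K_t$-minor, then $G$ does not contain $K_{2,4t}$ as a topological minor (that is, no subgraph of $G$ is isomorphic to a subdivision of $K_{2,4t}$).
   Context: A circular drawing of a graph $G$ places the vertices of $G$ at distinct points on a circle and draws each edge as the straight line segment between its endpoints. Two edges cross if their segments intersect at a point that is not an endpoint of either. The crossing graph of a circular drawing $D$ of $G$ is the graph with vertex set $E(G)$ in which two edges are adjacent if and only if they cross in $D$. -}

module Defs where

open import Data.Nat using (ℕ; _<_)
open import Data.Bool using (Bool; true)
open import Data.Fin using (Fin) renaming (_<_ to _<ᶠ_)
open import Data.Product using (Σ; ∃; _×_; _,_; proj₁; proj₂)
open import Data.Sum using (_⊎_)
open import Data.Empty using (⊥)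
open import Data.List using (List; []; _∷_)
open import Data.List.Membership.Propositional using (_∈_; _∉_)
open import Data.List.Relation.Unary.Unique.Propositional using (Unique)
open import Relation.Nullary using (¬_)
open import Relation.Binary.PropositionalEquality using (_≡_; _≢_)
open import Relation.Binary.Construct.Closure.ReflexiveTransitive using (Star)
open import Function.Definitions using (Injective)

record Graph : Set where
  field
    n     : ℕ
    adj   : Fin n → Fin n → Bool
    sym   : ∀ u v → adj u v ≡ adj v u
    irrefl : ∀ u → adj u u ≡ true → ⊥
  Adj : Fin n → Fin n → Set
  Adj u v = adj u v ≡ true

open Graph public

-- An edge {u,v} is represented once, as the pair (u , v) with u < v.
Edge : Graph → Set
Edge G = Σ (Fin (n G) × Fin (n G)) λ p → (proj₁ p <ᶠ proj₂ p) × Adj G (proj₁ p) (proj₂ p)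

-- Placing the vertices at distinct points of a circle is recorded by the
-- (injective) position of each vertex in the cyclic order, read off after
-- cutting the circle at a point carrying no vertex.  Whether two
-- straight-line chords cross depends only on this order.

record CircularDrawing (G : Graph) : Set where
  field
    pos    : Fin (n G) → ℕ
    pos-inj : Injective _≡_ _≡_ pos
open CircularDrawing public

module _ {G : Graph} (D : CircularDrawing G) where
  Between : Fin (n G) → Fin (n G) → Fin (n G) → Set
  Between a b x = ((pos D a < pos D x) × (pos D x < pos D b))
                ⊎ ((pos D b < pos D x) × (pos D x < pos D a))

  -- chords ab and cd cross (at a point that is not an endpoint) iff
  -- their four endpoints are distinct and interleave on the circle
  CrossChord : Fin (n G) → Fin (n G) → Fin (n G) → Fin (n G) → Set
  CrossChord a b c d =
      (Between a b c × ¬ Between a b d × d ≢ a × d ≢ b)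
    ⊎ (Between a b d × ¬ Between a b c × c ≢ a × c ≢ b)

  Cross : Edge G → Edge G → Set
  Cross ((a , b) , _) ((c , d) , _) = CrossChord a b c d

HasCliqueMinor : (V : Set) → (V → V → Set) → ℕ → Set₁
HasCliqueMinor V A t =
  Σ (Fin t → V → Set) λ B →
      (∀ i → ∃ λ v → B i v)
    × (∀ i j v → i ≢ j → B i v → ¬ B j v)
    × (∀ i u v → B i u → B i v →
         Star (λ x y → B i x × B i y × A x y) u v)
    × (∀ i j → i ≢ j → ∃ λ u → ∃ λ v → B i u × B j v × A u v)

IsPathVia : (G : Graph) → Fin (n G) → List (Fin (n G)) → Fin (n G) → Set
IsPathVia G a []      b = Adj G a b
IsPathVia G a (v ∷ l) b = Adj G a v × IsPathVia G v l b

record TopMinorK2 (G : Graph) (m : ℕ) : Set where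
  field
    x      : Fin 2 → Fin (n G)
    y      : Fin m → Fin (n G)
    x-inj  : Injective _≡_ _≡_ x
    y-inj  : Injective _≡_ _≡_ y
    xy-dis : ∀ i j → x i ≢ y j
    P      : Fin 2 → Fin m → List (Fin (n G))
    P-path : ∀ i j → IsPathVia G (x i) (P i j) (y j)
    P-uniq : ∀ i j → Unique (P i j)
    P-avoid-x : ∀ i j k → x k ∉ P i j
    P-avoid-y : ∀ i j k → y k ∉ P i j
    P-disj : ∀ i j i' j' v → (i , j) ≢ (i' , j') → v ∈ P i j → v ∉ P i' j'

ContainsTopK2 : Graph → ℕ → Set
ContainsTopK2 G m = TopMinorK2 G m

{-# OPTIONS --safe #-}
-- Cut the circle at x₀, so that x₀ is the leftmost vertex. Each of the 4t internally disjoint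
-- x₀–x₁ routes of the subdivision starts with a hub edge x₀f. By pigeonhole, 2t of the f lie on
-- the same side of x₁; pair them up. The branch set of a pair is the component, in the crossing
-- graph on the edges of both routes, of the hub edge whose f is nearer to x₁; these are connected
-- and, the routes being internally disjoint, disjoint. On each of the two routes take the last
-- vertex r touched by the component: the rest of the route crosses no edge of the component, so
-- no such edge separates r from x₁. If the f lie left of x₁ this forces the component to reach x₁
-- or beyond, and if they lie right of x₁ to reach between x₀ and x₁; otherwise the last touched
-- vertices of the two routes would coincide. Either way the component must cross the hub edge of
-- every pair whose hub ends further from x₀ (resp. nearer), so all branch sets are adjacent.
-- Components are not decidable, so all this is argued under double negation.
module Submission where

open import Defs
open import Data.Bool using (Bool; true; false)
open import Data.Empty using (⊥; ⊥-elim)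
open import Data.Fin using (Fin; zero; suc; toℕ; inject≤; splitAt; _↑ˡ_; _↑ʳ_)
import Data.Fin.Properties as Fin
open import Data.List using (List; []; _∷_; _++_; reverse; _∷ʳ_)
open import Data.List.Properties using (∷-injectiveʳ; ++-assoc; reverse-++; reverse-involutive; unfold-reverse)
open import Data.List.Membership.Propositional using (_∈_; lose)
open import Data.List.Membership.Propositional.Properties using (∈-++⁺ʳ; ∈-++⁻)
open import Data.List.Relation.Unary.All as All using (All)
open import Data.List.Relation.Unary.All.Properties using (¬Any⇒All¬; All¬⇒¬Any)
open import Data.List.Relation.Unary.Any using (Any; here; there)
open import Data.List.Relation.Unary.Any.Properties using (reverse⁻)
open import Data.Nat using (ℕ; zero; suc; _+_; _*_; _<_; _≤_; _≥_; _⊔_; _<?_; _≤?_; s≤s)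
open import Data.Nat.Properties
open import Data.Product using (∃; ∃₂; _×_; _,_; proj₁; proj₂; swap)
open import Data.Sum using (_⊎_; inj₁; inj₂; [_,_]′) renaming (swap to ⊎-swap)
open import Function using (_⇔_; mk⇔; Equivalence; id; _∘_)
open import Relation.Binary using (tri<; tri≈; tri>)
open import Relation.Binary.Construct.Closure.ReflexiveTransitive as Star using (Star; ε; _◅_; _◅◅_)
open import Relation.Binary.PropositionalEquality as ≡ using (_≡_; _≢_; refl; cong; subst; subst₂)
open import Relation.Nullary using (¬_; Dec; yes; no; ¬?)
open import Relation.Nullary.Decidable using (decidable-stable; ¬¬-excluded-middle)

open Equivalence using (to; from)

-- Intervals and interleaving in ℕ

Inside : ℕ → ℕ → ℕ → Set
Inside x y z = (x < z × z < y) ⊎ (y < z × z < x)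

Closed : ℕ → ℕ → ℕ → Set
Closed x y z = Inside x y z ⊎ z ≡ x ⊎ z ≡ y

Interleaved : ℕ → ℕ → ℕ → ℕ → Set
Interleaved x y z w = (Inside x y z × ¬ Inside x y w × w ≢ x × w ≢ y)
                    ⊎ (Inside x y w × ¬ Inside x y z × z ≢ x × z ≢ y)

inside? : ∀ x y z → Dec (Inside x y z)
inside? x y z with x <? z | z <? y | y <? z | z <? x
... | yes a | yes b | _     | _     = yes (inj₁ (a , b))
... | _     | _     | yes a | yes b = yes (inj₂ (a , b))
... | yes _ | no b  | no c  | _     = no λ { (inj₁ (_ , q)) → b q ; (inj₂ (p , _)) → c p }
... | yes _ | no b  | yes _ | no d  = no λ { (inj₁ (_ , q)) → b q ; (inj₂ (_ , q)) → d q }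
... | no a  | _     | no c  | _     = no λ { (inj₁ (p , _)) → a p ; (inj₂ (p , _)) → c p }
... | no a  | _     | yes _ | no d  = no λ { (inj₁ (p , _)) → a p ; (inj₂ (_ , q)) → d q }

inside-sym : ∀ {x y z} → Inside x y z → Inside y x z
inside-sym (inj₁ p) = inj₂ p
inside-sym (inj₂ p) = inj₁ p

inside⇒≢ˡ : ∀ {x y z} → Inside x y z → z ≢ x
inside⇒≢ˡ (inj₁ (xz , _)) refl = <-irrefl refl xz
inside⇒≢ˡ (inj₂ (_ , zx)) refl = <-irrefl refl zx

inside⇒≢ʳ : ∀ {x y z} → Inside x y z → z ≢ y
inside⇒≢ʳ (inj₁ (_ , zy)) refl = <-irrefl refl zy
inside⇒≢ʳ (inj₂ (yz , _)) refl = <-irrefl refl yz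

inside⇒< : ∀ {x y z r} → Inside x y z → x ≤ r → y ≤ r → z < r
inside⇒< (inj₁ (_ , zy)) _ yr = <-≤-trans zy yr
inside⇒< (inj₂ (_ , zx)) xr _ = <-≤-trans zx xr

inside⇒> : ∀ {x y z r} → Inside x y z → r ≤ x → r ≤ y → r < z
inside⇒> (inj₁ (xz , _)) rx _ = ≤-<-trans rx xz
inside⇒> (inj₂ (yz , _)) _ ry = ≤-<-trans ry yz

¬inside⇒outside : ∀ {x y w} → ¬ Inside x y w → w ≢ x → w ≢ y →
                  (w < x × w < y) ⊎ (x < w × y < w)
¬inside⇒outside {x} {y} {w} ¬in w≢x w≢y with <-cmp w x | <-cmp w y
... | tri≈ _ e _ | _          = ⊥-elim (w≢x e)
... | _          | tri≈ _ e _ = ⊥-elim (w≢y e)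
... | tri< a _ _ | tri< b _ _ = inj₁ (a , b)
... | tri> _ _ a | tri> _ _ b = inj₂ (a , b)
... | tri< a _ _ | tri> _ _ b = ⊥-elim (¬in (inj₂ (b , a)))
... | tri> _ _ a | tri< b _ _ = ⊥-elim (¬in (inj₁ (a , b)))

≤⇒closed : ∀ {x y z} → x < z → z ≤ y → Closed x y z
≤⇒closed xz zy with m≤n⇒m<n∨m≡n zy
... | inj₁ z<y = inj₁ (inj₁ (xz , z<y))
... | inj₂ z≡y = inj₂ (inj₂ z≡y)

interleaved-swapˡ : ∀ {x y z w} → Interleaved x y z w → Interleaved y x z w
interleaved-swapˡ (inj₁ (a , b , c , d)) = inj₁ (inside-sym a , (λ q → b (inside-sym q)) , d , c)
interleaved-swapˡ (inj₂ (a , b , c , d)) = inj₂ (inside-sym a , (λ q → b (inside-sym q)) , d , c)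

interleaved-sym : ∀ {x y z w} → Interleaved x y z w → Interleaved z w x y
interleaved-sym (inj₁ (a , b , c , d)) = one-inside a b c d
  where
  one-inside : ∀ {x y z w} → Inside x y z → ¬ Inside x y w → w ≢ x → w ≢ y → Interleaved z w x y
  one-inside (inj₁ (xz , zy)) ¬in w≢x w≢y with ¬inside⇒outside ¬in w≢x w≢y
  ... | inj₁ (wx , wy) = inj₁ (inj₂ (wx , xz) , (λ { (inj₁ (_ , q)) → <-asym wy q ; (inj₂ (_ , q)) → <-asym zy q }) ,
                               (λ e → <-irrefl (≡.sym e) zy) , λ e → w≢y (≡.sym e))
  ... | inj₂ (xw , yw) = inj₂ (inj₁ (zy , yw) , (λ { (inj₁ (p , _)) → <-asym p xz ; (inj₂ (p , _)) → <-asym p xw }) ,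
                               (λ e → <-irrefl e xz) , λ e → w≢x (≡.sym e))
  one-inside (inj₂ (yz , zx)) ¬in w≢x w≢y with ¬inside⇒outside ¬in w≢x w≢y
  ... | inj₁ (wx , wy) = inj₂ (inj₂ (wy , yz) , (λ { (inj₁ (_ , q)) → <-asym wx q ; (inj₂ (_ , q)) → <-asym zx q }) ,
                               (λ e → <-irrefl (≡.sym e) zx) , λ e → w≢x (≡.sym e))
  ... | inj₂ (xw , yw) = inj₁ (inj₁ (zx , xw) , (λ { (inj₁ (p , _)) → <-asym p yz ; (inj₂ (p , _)) → <-asym p yw }) ,
                               (λ e → <-irrefl e yz) , λ e → w≢y (≡.sym e))
interleaved-sym (inj₂ (a , b , c , d)) = interleaved-swapˡ (interleaved-sym (inj₁ (a , b , c , d)))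

closed⇒¬interleaved : ∀ {x y z w} → Closed x y z → Closed x y w → ¬ Interleaved x y z w
closed⇒¬interleaved _ (inj₁ w-in)        (inj₁ (_ , ¬w-in , _)) = ¬w-in w-in
closed⇒¬interleaved _ (inj₂ (inj₁ w≡x)) (inj₁ (_ , _ , w≢x , _)) = w≢x w≡x
closed⇒¬interleaved _ (inj₂ (inj₂ w≡y)) (inj₁ (_ , _ , _ , w≢y)) = w≢y w≡y
closed⇒¬interleaved (inj₁ z-in)        _ (inj₂ (_ , ¬z-in , _)) = ¬z-in z-in
closed⇒¬interleaved (inj₂ (inj₁ z≡x)) _ (inj₂ (_ , _ , z≢x , _)) = z≢x z≡x
closed⇒¬interleaved (inj₂ (inj₂ z≡y)) _ (inj₂ (_ , _ , _ , z≢y)) = z≢y z≡y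

¬inside⇒¬interleaved : ∀ {x y z w} → ¬ Inside x y z → ¬ Inside x y w → ¬ Interleaved x y z w
¬inside⇒¬interleaved ¬z _ (inj₁ (z-in , _)) = ¬z z-in
¬inside⇒¬interleaved _ ¬w (inj₂ (w-in , _)) = ¬w w-in

interleaved-≤ : ∀ {x y z w r} → x ≤ r → y ≤ r → ¬ Inside z w r → Interleaved x y z w → z ≤ r × w ≤ r
interleaved-≤ xr yr ¬r (inj₁ (z-in , _)) =
  let z<r = inside⇒< z-in xr yr in <⇒≤ z<r , ≮⇒≥ (λ r<w → ¬r (inj₁ (z<r , r<w)))
interleaved-≤ xr yr ¬r (inj₂ (w-in , _)) =
  let w<r = inside⇒< w-in xr yr in ≮⇒≥ (λ r<z → ¬r (inj₂ (w<r , r<z))) , <⇒≤ w<r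

-- Cutting the circle at K instead of at 0: positions below K move past all others,
-- which are assumed to be below M.
module Rotation (K M : ℕ) where

  rotate : ℕ → ℕ
  rotate x with K ≤? x
  ... | yes _ = x
  ... | no _  = x + M

  data Side (x : ℕ) : Set where
    upper : K ≤ x → Side x
    lower : x < K → Side x

  side : ∀ x → Side x
  side x with K ≤? x
  ... | yes K≤x = upper K≤x
  ... | no K≰x  = lower (≰⇒> K≰x)

  rotate-upper : ∀ {x} → K ≤ x → rotate x ≡ x
  rotate-upper {x} K≤x with K ≤? x
  ... | yes _   = refl
  ... | no K≰x  = ⊥-elim (K≰x K≤x)

  rotate-lower : ∀ {x} → x < K → rotate x ≡ x + M
  rotate-lower {x} x<K with K ≤? x
  ... | yes K≤x = ⊥-elim (<⇒≱ x<K K≤x)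
  ... | no _    = refl

  rotate-<-upper : ∀ {u v} → K ≤ u → K ≤ v → (rotate u < rotate v) ⇔ (u < v)
  rotate-<-upper Ku Kv rewrite rotate-upper Ku | rotate-upper Kv = mk⇔ id id

  rotate-<-lower : ∀ {u v} → u < K → v < K → (rotate u < rotate v) ⇔ (u < v)
  rotate-<-lower {u} {v} uK vK rewrite rotate-lower uK | rotate-lower vK =
    mk⇔ (+-cancelʳ-< M u v) (+-monoˡ-< M)

  rotate-upper<lower : ∀ {u v} → K ≤ u → v < K → u < M → rotate u < rotate v × v < u
  rotate-upper<lower {u} {v} Ku vK u<M rewrite rotate-upper Ku | rotate-lower vK =
    <-≤-trans u<M (m≤n+m M v) , <-≤-trans vK Ku

  rotate-injective : ∀ {u v} → u < M → v < M → rotate u ≡ rotate v → u ≡ v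
  rotate-injective {u} {v} u<M v<M eq with side u | side v
  ... | upper Ku | upper Kv rewrite rotate-upper Ku | rotate-upper Kv = eq
  ... | lower uK | lower vK rewrite rotate-lower uK | rotate-lower vK = +-cancelʳ-≡ M u v eq
  ... | upper Ku | lower vK = ⊥-elim (<-irrefl eq (proj₁ (rotate-upper<lower Ku vK u<M)))
  ... | lower uK | upper Kv = ⊥-elim (<-irrefl (≡.sym eq) (proj₁ (rotate-upper<lower Kv uK v<M)))

  module _ {x y z : ℕ} (x<M : x < M) (y<M : y < M) (z<M : z < M) where

    inside-rotate-upper : K ≤ x → K ≤ y → Inside (rotate x) (rotate y) (rotate z) ⇔ Inside x y z
    inside-rotate-upper Kx Ky with side z
    ... | upper Kz = mk⇔
      (λ { (inj₁ (a , b)) → inj₁ (to (rotate-<-upper Kx Kz) a , to (rotate-<-upper Kz Ky) b)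
         ; (inj₂ (a , b)) → inj₂ (to (rotate-<-upper Ky Kz) a , to (rotate-<-upper Kz Kx) b) })
      (λ { (inj₁ (a , b)) → inj₁ (from (rotate-<-upper Kx Kz) a , from (rotate-<-upper Kz Ky) b)
         ; (inj₂ (a , b)) → inj₂ (from (rotate-<-upper Ky Kz) a , from (rotate-<-upper Kz Kx) b) })
    ... | lower zK = mk⇔
      (λ { (inj₁ (_ , b)) → ⊥-elim (<-asym b (proj₁ (rotate-upper<lower Ky zK y<M)))
         ; (inj₂ (_ , b)) → ⊥-elim (<-asym b (proj₁ (rotate-upper<lower Kx zK x<M))) })
      (λ { (inj₁ (a , _)) → ⊥-elim (<-asym a (proj₂ (rotate-upper<lower Kx zK x<M)))
         ; (inj₂ (a , _)) → ⊥-elim (<-asym a (proj₂ (rotate-upper<lower Ky zK y<M))) })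

    inside-rotate-lower : x < K → y < K → Inside (rotate x) (rotate y) (rotate z) ⇔ Inside x y z
    inside-rotate-lower xK yK with side z
    ... | lower zK = mk⇔
      (λ { (inj₁ (a , b)) → inj₁ (to (rotate-<-lower xK zK) a , to (rotate-<-lower zK yK) b)
         ; (inj₂ (a , b)) → inj₂ (to (rotate-<-lower yK zK) a , to (rotate-<-lower zK xK) b) })
      (λ { (inj₁ (a , b)) → inj₁ (from (rotate-<-lower xK zK) a , from (rotate-<-lower zK yK) b)
         ; (inj₂ (a , b)) → inj₂ (from (rotate-<-lower yK zK) a , from (rotate-<-lower zK xK) b) })
    ... | upper Kz = mk⇔
      (λ { (inj₁ (a , _)) → ⊥-elim (<-asym a (proj₁ (rotate-upper<lower Kz xK z<M)))
         ; (inj₂ (a , _)) → ⊥-elim (<-asym a (proj₁ (rotate-upper<lower Kz yK z<M))) })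
      (λ { (inj₁ (_ , b)) → ⊥-elim (<-asym b (proj₂ (rotate-upper<lower Kz yK z<M)))
         ; (inj₂ (_ , b)) → ⊥-elim (<-asym b (proj₂ (rotate-upper<lower Kz xK z<M))) })

    inside-rotate-across : x < K → K ≤ y → z ≢ x → z ≢ y →
                           Inside (rotate x) (rotate y) (rotate z) ⇔ (¬ Inside x y z)
    inside-rotate-across xK Ky z≢x z≢y = mk⇔ (to′ (side z)) (from′ (side z))
      where
      y>x : rotate y < rotate x
      y>x = proj₁ (rotate-upper<lower Ky xK y<M)
      to′ : Side z → Inside (rotate x) (rotate y) (rotate z) → ¬ Inside x y z
      to′ _         (inj₁ (a , b)) _              = <-asym (<-trans a b) y>x
      to′ (lower zK) (inj₂ (_ , b)) (inj₁ (c , _)) = <-asym c (to (rotate-<-lower zK xK) b)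
      to′ (lower zK) (inj₂ (_ , _)) (inj₂ (c , _)) = <-asym c (proj₂ (rotate-upper<lower Ky zK y<M))
      to′ (upper Kz) (inj₂ (a , _)) (inj₁ (_ , d)) = <-asym d (to (rotate-<-upper Ky Kz) a)
      to′ (upper Kz) (inj₂ (_ , _)) (inj₂ (_ , d)) = <-asym d (proj₂ (rotate-upper<lower Kz xK z<M))
      from′ : Side z → ¬ Inside x y z → Inside (rotate x) (rotate y) (rotate z)
      from′ (lower zK) ¬in with <-cmp z x
      ... | tri< z<x _ _ = inj₂ (proj₁ (rotate-upper<lower Ky zK y<M) , from (rotate-<-lower zK xK) z<x)
      ... | tri≈ _ e _   = ⊥-elim (z≢x e)
      ... | tri> _ _ x<z = ⊥-elim (¬in (inj₁ (x<z , proj₂ (rotate-upper<lower Ky zK y<M))))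
      from′ (upper Kz) ¬in with <-cmp z y
      ... | tri< z<y _ _ = ⊥-elim (¬in (inj₁ (proj₂ (rotate-upper<lower Kz xK z<M) , z<y)))
      ... | tri≈ _ e _   = ⊥-elim (z≢y e)
      ... | tri> _ _ y<z = inj₂ (from (rotate-<-upper Ky Kz) y<z , proj₁ (rotate-upper<lower Kz xK z<M))

  module _ {x y z w : ℕ} (x<M : x < M) (y<M : y < M) (z<M : z < M) (w<M : w < M) where

    private
      rotate-≢ : ∀ {u v} → rotate u ≢ rotate v → u ≢ v
      rotate-≢ ne eq = ne (cong rotate eq)

    interleaved-rotate-same : (∀ {v} → v < M → Inside (rotate x) (rotate y) (rotate v) ⇔ Inside x y v) →
                              Interleaved (rotate x) (rotate y) (rotate z) (rotate w) → Interleaved x y z w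
    interleaved-rotate-same ins (inj₁ (a , b , c , d)) =
      inj₁ (to (ins z<M) a , (λ q → b (from (ins w<M) q)) , rotate-≢ c , rotate-≢ d)
    interleaved-rotate-same ins (inj₂ (a , b , c , d)) =
      inj₂ (to (ins w<M) a , (λ q → b (from (ins z<M) q)) , rotate-≢ c , rotate-≢ d)

    interleaved-rotate-across : x < K → K ≤ y →
                                Interleaved (rotate x) (rotate y) (rotate z) (rotate w) → Interleaved x y z w
    interleaved-rotate-across xK Ky (inj₁ (a , b , c , d)) =
      let z≢x = rotate-≢ (inside⇒≢ˡ a) ; z≢y = rotate-≢ (inside⇒≢ʳ a)
          w-across = inside-rotate-across x<M y<M w<M xK Ky (rotate-≢ c) (rotate-≢ d)
      in inj₂ ( decidable-stable (inside? x y w) (λ ¬in → b (from w-across ¬in))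
              , to (inside-rotate-across x<M y<M z<M xK Ky z≢x z≢y) a , z≢x , z≢y)
    interleaved-rotate-across xK Ky (inj₂ (a , b , c , d)) =
      let w≢x = rotate-≢ (inside⇒≢ˡ a) ; w≢y = rotate-≢ (inside⇒≢ʳ a)
          z-across = inside-rotate-across x<M y<M z<M xK Ky (rotate-≢ c) (rotate-≢ d)
      in inj₁ ( decidable-stable (inside? x y z) (λ ¬in → b (from z-across ¬in))
              , to (inside-rotate-across x<M y<M w<M xK Ky w≢x w≢y) a , w≢x , w≢y)

  interleaved-rotate⁻ : ∀ {x y z w} → x < M → y < M → z < M → w < M →
                        Interleaved (rotate x) (rotate y) (rotate z) (rotate w) → Interleaved x y z w
  interleaved-rotate⁻ {x} {y} x<M y<M z<M w<M c with side x | side y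
  ... | upper Kx | upper Ky = interleaved-rotate-same x<M y<M z<M w<M (λ v<M → inside-rotate-upper x<M y<M v<M Kx Ky) c
  ... | lower xK | lower yK = interleaved-rotate-same x<M y<M z<M w<M (λ v<M → inside-rotate-lower x<M y<M v<M xK yK) c
  ... | lower xK | upper Ky = interleaved-rotate-across x<M y<M z<M w<M xK Ky c
  ... | upper Kx | lower yK =
    interleaved-swapˡ (interleaved-rotate-across y<M x<M z<M w<M yK Kx (interleaved-swapˡ c))


-- Consecutive elements of a list

data Consecutive {A : Set} : List A → A → A → Set where
  here  : ∀ {u v L} → Consecutive (u ∷ v ∷ L) u v
  there : ∀ {x u v L} → Consecutive L u v → Consecutive (x ∷ L) u v

module _ {A : Set} where

  consecutive-++⁺ʳ : ∀ K {L} {u v : A} → Consecutive L u v → Consecutive (K ++ L) u v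
  consecutive-++⁺ʳ []      c = c
  consecutive-++⁺ʳ (_ ∷ K) c = there (consecutive-++⁺ʳ K c)

  consecutive-++⁺ˡ : ∀ {K} L {u v : A} → Consecutive K u v → Consecutive (K ++ L) u v
  consecutive-++⁺ˡ L here      = here
  consecutive-++⁺ˡ L (there c) = there (consecutive-++⁺ˡ L c)

  consecutive⇒∈ˡ : ∀ {L} {u v : A} → Consecutive L u v → u ∈ L
  consecutive⇒∈ˡ here      = here refl
  consecutive⇒∈ˡ (there c) = there (consecutive⇒∈ˡ c)

  consecutive⇒∈ʳ : ∀ {L} {u v : A} → Consecutive L u v → v ∈ L
  consecutive⇒∈ʳ here      = there (here refl)
  consecutive⇒∈ʳ (there c) = there (consecutive⇒∈ʳ c)

  consecutive-++⁻ : ∀ K {y : A} {L u v} → Consecutive (K ++ y ∷ L) u v →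
                    Consecutive (K ∷ʳ y) u v ⊎ Consecutive (y ∷ L) u v
  consecutive-++⁻ []          c         = inj₂ c
  consecutive-++⁻ (_ ∷ [])    here      = inj₁ here
  consecutive-++⁻ (_ ∷ [])    (there c) = inj₂ c
  consecutive-++⁻ (_ ∷ _ ∷ K) here      = inj₁ here
  consecutive-++⁻ (_ ∷ x ∷ K) (there c) with consecutive-++⁻ (x ∷ K) c
  ... | inj₁ d = inj₁ (there d)
  ... | inj₂ d = inj₂ d

  consecutive-reverse : ∀ {L} {u v : A} → Consecutive L u v → Consecutive (reverse L) v u
  consecutive-reverse {u ∷ v ∷ L} here
    rewrite unfold-reverse u (v ∷ L) | unfold-reverse v L | ++-assoc (reverse L) (v ∷ []) (u ∷ [])
    = consecutive-++⁺ʳ (reverse L) here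
  consecutive-reverse {x ∷ L} (there c) rewrite unfold-reverse x L =
    consecutive-++⁺ˡ (x ∷ []) (consecutive-reverse c)

  consecutive-∷ʳ⇒∈ : ∀ L {b u v : A} → Consecutive (L ∷ʳ b) u v → u ∈ L
  consecutive-∷ʳ⇒∈ []          (there ())
  consecutive-∷ʳ⇒∈ (_ ∷ [])    here              = here refl
  consecutive-∷ʳ⇒∈ (_ ∷ [])    (there (there ()))
  consecutive-∷ʳ⇒∈ (_ ∷ _ ∷ L) here              = here refl
  consecutive-∷ʳ⇒∈ (_ ∷ x ∷ L) (there c)         = there (consecutive-∷ʳ⇒∈ (x ∷ L) c)

  discrete-ivt : (P : A → Set) → (∀ z → Dec (P z)) → ∀ {x y} l → P x → y ∈ x ∷ l → ¬ P y →
                 ∃₂ λ u v → Consecutive (x ∷ l) u v × P u × ¬ P v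
  discrete-ivt P P? []      px (here refl) ¬py = ⊥-elim (¬py px)
  discrete-ivt P P? (_ ∷ _) px (here refl) ¬py = ⊥-elim (¬py px)
  discrete-ivt P P? {x} (x′ ∷ l) px (there y∈) ¬py with P? x′
  ... | no ¬px′ = x , x′ , here , px , ¬px′
  ... | yes px′ with discrete-ivt P P? l px′ y∈ ¬py
  ...   | u , v , c , pu , ¬pv = u , v , there c , pu , ¬pv

  record SplitAtLast (Q : A → Set) (L : List A) : Set where
    field
      before : List A
      last   : A
      after  : List A
      split  : L ≡ before ++ last ∷ after
      holds  : Q last
      fails  : All (¬_ ∘ Q) after

  -- Q need not be decidable, hence the double negation.
  ¬¬-splitAtLast : (Q : A → Set) → ∀ L → Any Q L → ¬ ¬ SplitAtLast Q L
  ¬¬-splitAtLast Q (x ∷ l) q k = ¬¬-excluded-middle λ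
    { (yes q-l) → ¬¬-splitAtLast Q l q-l (k ∘ prepend)
    ; (no ¬q-l) → k (at-head q ¬q-l) }
    where
    prepend : SplitAtLast Q l → SplitAtLast Q (x ∷ l)
    prepend s = record { before = x ∷ before ; split = cong (x ∷_) split ; holds = holds ; fails = fails }
      where open SplitAtLast s
    at-head : Any Q (x ∷ l) → ¬ Any Q l → SplitAtLast Q (x ∷ l)
    at-head (here qx)  ¬q-l = record { before = [] ; split = refl ; holds = qx ; fails = ¬Any⇒All¬ l ¬q-l }
    at-head (there q-l) ¬q-l = ⊥-elim (¬q-l q-l)

  ∈-after : ∀ K {r : A} {R} L {b} → K ++ r ∷ R ≡ L ∷ʳ b → r ≢ b → b ∈ R
  ∈-after []      []      refl r≢b = ⊥-elim (r≢b refl)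
  ∈-after []      (_ ∷ L) refl _   = ∈-++⁺ʳ L (here refl)
  ∈-after (_ ∷ []) [] () _
  ∈-after (_ ∷ _ ∷ _) [] () _
  ∈-after (_ ∷ K) (_ ∷ L) eq r≢b = ∈-after K L (∷-injectiveʳ eq) r≢b


-- Graphs, edges and drawings

module _ (G : Graph) where

  adj-sym : ∀ {u v} → Adj G u v → Adj G v u
  adj-sym {u} {v} a = ≡.trans (≡.sym (sym G u v)) a

  adj⇒≢ : ∀ {u v} → Adj G u v → u ≢ v
  adj⇒≢ a refl = irrefl G _ a

module Edges (G : Graph) where

  end₁ end₂ : Edge G → Fin (n G)
  end₁ e = proj₁ (proj₁ e)
  end₂ e = proj₂ (proj₁ e)

  end₁≢end₂ : ∀ e → end₁ e ≢ end₂ e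
  end₁≢end₂ (_ , u<v , _) eq = <-irrefl (cong toℕ eq) u<v

  edge : ∀ u v → Adj G u v → Edge G
  edge u v a with Fin.<-cmp u v
  ... | tri< u<v _ _ = (u , v) , u<v , a
  ... | tri≈ _ u≡v _ = ⊥-elim (adj⇒≢ G a u≡v)
  ... | tri> _ _ v<u = (v , u) , v<u , adj-sym G a

  Ends : Edge G → Fin (n G) → Fin (n G) → Set
  Ends e u v = (end₁ e ≡ u × end₂ e ≡ v) ⊎ (end₁ e ≡ v × end₂ e ≡ u)

  edge-ends : ∀ u v a → Ends (edge u v a) u v
  edge-ends u v a with Fin.<-cmp u v
  ... | tri< _ _ _   = inj₁ (refl , refl)
  ... | tri≈ _ u≡v _ = ⊥-elim (adj⇒≢ G a u≡v)
  ... | tri> _ _ _   = inj₂ (refl , refl)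

module _ {G : Graph} (D : CircularDrawing G) where

  crossChord⇒interleaved : ∀ {a b c d} → CrossChord D a b c d →
                           Interleaved (pos D a) (pos D b) (pos D c) (pos D d)
  crossChord⇒interleaved (inj₁ (p , q , r , s)) = inj₁ (p , q , (λ e → r (pos-inj D e)) , λ e → s (pos-inj D e))
  crossChord⇒interleaved (inj₂ (p , q , r , s)) = inj₂ (p , q , (λ e → r (pos-inj D e)) , λ e → s (pos-inj D e))

  interleaved⇒crossChord : ∀ {a b c d} → Interleaved (pos D a) (pos D b) (pos D c) (pos D d) →
                           CrossChord D a b c d
  interleaved⇒crossChord (inj₁ (p , q , r , s)) = inj₁ (p , q , (λ e → r (cong (pos D) e)) , λ e → s (cong (pos D) e))
  interleaved⇒crossChord (inj₂ (p , q , r , s)) = inj₂ (p , q , (λ e → r (cong (pos D) e)) , λ e → s (cong (pos D) e))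

  crossChord-sym : ∀ {a b c d} → CrossChord D a b c d → CrossChord D c d a b
  crossChord-sym = interleaved⇒crossChord ∘ interleaved-sym ∘ crossChord⇒interleaved

  crossChord-swapˡ : ∀ {a b c d} → CrossChord D a b c d → CrossChord D b a c d
  crossChord-swapˡ = interleaved⇒crossChord ∘ interleaved-swapˡ ∘ crossChord⇒interleaved

  crossChord-swapʳ : ∀ {a b c d} → CrossChord D a b c d → CrossChord D a b d c
  crossChord-swapʳ (inj₁ p) = inj₂ p
  crossChord-swapʳ (inj₂ p) = inj₁ p

  open Edges G

  crossChord-endsʳ : ∀ {a b c d e} → Ends e c d → CrossChord D a b c d → CrossChord D a b (end₁ e) (end₂ e)
  crossChord-endsʳ (inj₁ (refl , refl)) x = x
  crossChord-endsʳ (inj₂ (refl , refl)) x = crossChord-swapʳ x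

  crossChord-endsˡ : ∀ {a b c d e} → Ends e a b → CrossChord D a b c d → CrossChord D (end₁ e) (end₂ e) c d
  crossChord-endsˡ (inj₁ (refl , refl)) x = x
  crossChord-endsˡ (inj₂ (refl , refl)) x = crossChord-swapˡ x

  crossChord-endsˡ⁻ : ∀ {a b c d e} → Ends e a b → CrossChord D (end₁ e) (end₂ e) c d → CrossChord D a b c d
  crossChord-endsˡ⁻ (inj₁ (refl , refl)) x = x
  crossChord-endsˡ⁻ (inj₂ (refl , refl)) x = crossChord-swapˡ x

max-of : ∀ k → (Fin k → ℕ) → ℕ
max-of zero    g = 0
max-of (suc k) g = g zero ⊔ max-of k (g ∘ suc)

≤-max-of : ∀ k g (i : Fin k) → g i ≤ max-of k g
≤-max-of (suc k) g zero    = m≤m⊔n _ _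
≤-max-of (suc k) g (suc i) = ≤-trans (≤-max-of k (g ∘ suc) i) (m≤n⊔m _ _)

record LeftmostRedrawing {G : Graph} (D : CircularDrawing G) (a : Fin (n G)) : Set where
  field
    drawing     : CircularDrawing G
    leftmost    : ∀ v → v ≢ a → pos drawing a < pos drawing v
    crossChord⁻ : ∀ {u v w z} → CrossChord drawing u v w z → CrossChord D u v w z

leftmostRedrawing : ∀ {G} (D : CircularDrawing G) a → LeftmostRedrawing D a
leftmostRedrawing {G} D a = record
  { drawing     = D′
  ; leftmost    = leftmost
  ; crossChord⁻ = λ c → interleaved⇒crossChord D
      (interleaved-rotate⁻ (pos<M _) (pos<M _) (pos<M _) (pos<M _) (crossChord⇒interleaved D′ c))
  }
  where
  M : ℕ
  M = suc (max-of (n G) (pos D))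

  pos<M : ∀ v → pos D v < M
  pos<M v = s≤s (≤-max-of (n G) (pos D) v)

  open Rotation (pos D a) M

  D′ : CircularDrawing G
  D′ = record { pos = rotate ∘ pos D ; pos-inj = pos-inj D ∘ rotate-injective (pos<M _) (pos<M _) }

  leftmost : ∀ v → v ≢ a → rotate (pos D a) < rotate (pos D v)
  leftmost v v≢a rewrite rotate-upper {pos D a} ≤-refl with side (pos D v)
  ... | upper a≤v rewrite rotate-upper a≤v = ≤∧≢⇒< a≤v (λ e → v≢a (pos-inj D (≡.sym e)))
  ... | lower v<a rewrite rotate-lower v<a = <-≤-trans (pos<M a) (m≤n+m M (pos D v))


-- The x₀–x₁ routes of a subdivided K₂,ₘ

++-∷-uncons : ∀ {A : Set} (L : List A) d R → ∃₂ λ h t → L ++ d ∷ R ≡ h ∷ t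
++-∷-uncons []      d R = d , R , refl
++-∷-uncons (x ∷ L) d R = x , L ++ d ∷ R , refl

module Routes {G : Graph} {m : ℕ} (T : TopMinorK2 G m) where
  open TopMinorK2 T

  x₀ x₁ : Fin (n G)
  x₀ = x zero
  x₁ = x (suc zero)

  x₀≢x₁ : x₀ ≢ x₁
  x₀≢x₁ eq with x-inj eq
  ... | ()

  interior : Fin m → List (Fin (n G))
  interior j = P zero j ++ y j ∷ reverse (P (suc zero) j)

  onward : Fin m → List (Fin (n G))
  onward j = interior j ∷ʳ x₁

  route : Fin m → List (Fin (n G))
  route j = x₀ ∷ onward j

  first : Fin m → Fin (n G)
  first j = proj₁ (++-∷-uncons (P zero j) (y j) (reverse (P (suc zero) j)))

  interior-≡ : ∀ j → ∃ λ l → interior j ≡ first j ∷ l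
  interior-≡ j = proj₂ (++-∷-uncons (P zero j) (y j) (reverse (P (suc zero) j)))

  Interior : Fin m → Fin (n G) → Set
  Interior j z = z ∈ P zero j ⊎ z ≡ y j ⊎ z ∈ P (suc zero) j

  private
    isPathVia⇒adj : ∀ a l b → IsPathVia G a l b → ∀ {u v} → Consecutive (a ∷ l ∷ʳ b) u v → Adj G u v
    isPathVia⇒adj a []      b p       here              = p
    isPathVia⇒adj a []      b p       (there (there ()))
    isPathVia⇒adj a (w ∷ l) b (p , _) here              = p
    isPathVia⇒adj a (w ∷ l) b (_ , q) (there c)         = isPathVia⇒adj w l b q c

    route-≡ : ∀ j → route j ≡ (x₀ ∷ P zero j) ++ y j ∷ (reverse (P (suc zero) j) ∷ʳ x₁)
    route-≡ j = cong (x₀ ∷_) (++-assoc (P zero j) (y j ∷ reverse (P (suc zero) j)) (x₁ ∷ []))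

    reverse-path₁ : ∀ j → reverse (x₁ ∷ P (suc zero) j ∷ʳ y j) ≡ y j ∷ (reverse (P (suc zero) j) ∷ʳ x₁)
    reverse-path₁ j = ≡.trans (unfold-reverse x₁ (P (suc zero) j ∷ʳ y j))
                              (cong (_∷ʳ x₁) (reverse-++ (P (suc zero) j) (y j ∷ [])))

  route-adj : ∀ j {u v} → Consecutive (route j) u v → Adj G u v
  route-adj j {u} {v} c with consecutive-++⁻ (x₀ ∷ P zero j) (subst (λ L → Consecutive L u v) (route-≡ j) c)
  ... | inj₁ d = isPathVia⇒adj x₀ (P zero j) (y j) (P-path zero j) d
  ... | inj₂ d = adj-sym G (isPathVia⇒adj x₁ (P (suc zero) j) (y j) (P-path (suc zero) j)
      (subst (λ L → Consecutive L v u) (reverse-involutive (x₁ ∷ P (suc zero) j ∷ʳ y j))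
        (consecutive-reverse (subst (λ L → Consecutive L u v) (≡.sym (reverse-path₁ j)) d))))

  route-first : ∀ j → Consecutive (route j) x₀ (first j)
  route-first j with interior-≡ j
  ... | l , eq rewrite eq = here

  ∈-interior⁻ : ∀ j {z} → z ∈ interior j → Interior j z
  ∈-interior⁻ j z∈ with ∈-++⁻ (P zero j) z∈
  ... | inj₁ p            = inj₁ p
  ... | inj₂ (here p)     = inj₂ (inj₁ p)
  ... | inj₂ (there p)    = inj₂ (inj₂ (reverse⁻ p))

  first-interior : ∀ j → Interior j (first j)
  first-interior j with interior-≡ j
  ... | l , eq = ∈-interior⁻ j (subst (first j ∈_) (≡.sym eq) (here refl))

  ∈-onward⁻ : ∀ j {z} → z ∈ onward j → Interior j z ⊎ z ≡ x₁
  ∈-onward⁻ j z∈ with ∈-++⁻ (interior j) z∈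
  ... | inj₁ p          = inj₁ (∈-interior⁻ j p)
  ... | inj₂ (here p)   = inj₂ p
  ... | inj₂ (there ())

  x₁∈onward : ∀ j → x₁ ∈ onward j
  x₁∈onward j = ∈-++⁺ʳ (interior j) (here refl)

  interior≢x : ∀ j {z} k → Interior j z → z ≢ x k
  interior≢x j k (inj₁ p)         refl = P-avoid-x zero j k p
  interior≢x j k (inj₂ (inj₁ e))  e′   = xy-dis k j (≡.trans (≡.sym e′) e)
  interior≢x j k (inj₂ (inj₂ p))  refl = P-avoid-x (suc zero) j k p

  interior≢x₀ : ∀ j {z} → Interior j z → z ≢ x₀
  interior≢x₀ j = interior≢x j zero

  interior≢x₁ : ∀ j {z} → Interior j z → z ≢ x₁
  interior≢x₁ j = interior≢x j (suc zero)

  interior-disjoint : ∀ j k {z} → Interior j z → Interior k z → j ≡ k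
  interior-disjoint j k = go
    where
    paths : ∀ i i′ {z} → z ∈ P i j → z ∈ P i′ k → j ≡ k
    paths i i′ p q with j Fin.≟ k
    ... | yes j≡k = j≡k
    ... | no j≢k  = ⊥-elim (P-disj i j i′ k _ (j≢k ∘ cong proj₂) p q)
    go : ∀ {z} → Interior j z → Interior k z → j ≡ k
    go (inj₁ p)        (inj₁ q)        = paths zero zero p q
    go (inj₁ p)        (inj₂ (inj₁ e)) = ⊥-elim (P-avoid-y zero j k (subst (_∈ P zero j) e p))
    go (inj₁ p)        (inj₂ (inj₂ q)) = paths zero (suc zero) p q
    go (inj₂ (inj₁ e)) (inj₁ q)        = ⊥-elim (P-avoid-y zero k j (subst (_∈ P zero k) e q))
    go (inj₂ (inj₁ e)) (inj₂ (inj₁ e′)) = y-inj (≡.trans (≡.sym e) e′)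
    go (inj₂ (inj₁ e)) (inj₂ (inj₂ q)) = ⊥-elim (P-avoid-y (suc zero) k j (subst (_∈ P (suc zero) k) e q))
    go (inj₂ (inj₂ p)) (inj₁ q)        = paths (suc zero) zero p q
    go (inj₂ (inj₂ p)) (inj₂ (inj₁ e)) = ⊥-elim (P-avoid-y (suc zero) j k (subst (_∈ P (suc zero) j) e p))
    go (inj₂ (inj₂ p)) (inj₂ (inj₂ q)) = paths (suc zero) (suc zero) p q

  ∈-route⁻ : ∀ j {z} → z ∈ route j → z ≡ x₀ ⊎ Interior j z ⊎ z ≡ x₁
  ∈-route⁻ j (here e)  = inj₁ e
  ∈-route⁻ j (there p) = inj₂ (∈-onward⁻ j p)

  -- x₀ and x₁ are never adjacent on a route, as y j lies in between.
  consecutive-route⇒interior : ∀ j {u v} → Consecutive (route j) u v → Interior j u ⊎ Interior j v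
  consecutive-route⇒interior j {u} {v} c with interior-≡ j
  ... | l , eq = go (subst (λ L → Consecutive (x₀ ∷ L ∷ʳ x₁) u v) eq c)
    where
    go : Consecutive (x₀ ∷ (first j ∷ l) ∷ʳ x₁) u v → Interior j u ⊎ Interior j v
    go here      = inj₂ (first-interior j)
    go (there d) = inj₁ (∈-interior⁻ j (subst (u ∈_) (≡.sym eq) (consecutive-∷ʳ⇒∈ (first j ∷ l) d)))


-- A subdivided K₂,ₘ in a drawing with x₀ leftmost

module Leftmost {G : Graph} {m : ℕ} (T : TopMinorK2 G m) (D : CircularDrawing G)
                (x₀-leftmost : ∀ v → v ≢ TopMinorK2.x T zero → pos D (TopMinorK2.x T zero) < pos D v) where

  open Routes T public
  open Edges G public

  V : Set
  V = Fin (n G)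

  p : V → ℕ
  p = pos D

  p-injective : ∀ {u v} → p u ≡ p v → u ≡ v
  p-injective = pos-inj D

  x₀<p : ∀ {v} → v ≢ x₀ → p x₀ < p v
  x₀<p = x₀-leftmost _

  x₀≤p : ∀ z → p x₀ ≤ p z
  x₀≤p z with z Fin.≟ x₀
  ... | yes refl  = ≤-refl
  ... | no z≢x₀   = <⇒≤ (x₀<p z≢x₀)

  x₀<x₁ : p x₀ < p x₁
  x₀<x₁ = x₀<p (x₀≢x₁ ∘ ≡.sym)

  x₀-¬inside : ∀ {u v} → ¬ Between D u v x₀
  x₀-¬inside {u} (inj₁ (a , _)) = <⇒≱ a (x₀≤p u)
  x₀-¬inside {_} {v} (inj₂ (a , _)) = <⇒≱ a (x₀≤p v)

  ends-both : ∀ {e u v} (Φ : V → Set) → Ends e u v → Φ u → Φ v → Φ (end₁ e) × Φ (end₂ e)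
  ends-both Φ (inj₁ (refl , refl)) φu φv = φu , φv
  ends-both Φ (inj₂ (refl , refl)) φu φv = φv , φu

  ends-both⁻ : ∀ {e u v} (Φ : V → Set) → Ends e u v → Φ (end₁ e) → Φ (end₂ e) → Φ u × Φ v
  ends-both⁻ Φ (inj₁ (refl , refl)) φ₁ φ₂ = φ₁ , φ₂
  ends-both⁻ Φ (inj₂ (refl , refl)) φ₁ φ₂ = φ₂ , φ₁

  ends-inside : ∀ {e u v z} → Ends e u v → Between D u v z → Between D (end₁ e) (end₂ e) z
  ends-inside (inj₁ (refl , refl)) b = b
  ends-inside (inj₂ (refl , refl)) b = inside-sym b

  ends-≢ : ∀ {e u v} → Ends e u v → u ≢ v
  ends-≢ {e} (inj₁ (refl , refl)) = end₁≢end₂ e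
  ends-≢ {e} (inj₂ (refl , refl)) = end₁≢end₂ e ∘ ≡.sym

  x₀-end? : ∀ e → (∃ λ v → Ends e x₀ v) ⊎ (end₁ e ≢ x₀ × end₂ e ≢ x₀)
  x₀-end? e with end₁ e Fin.≟ x₀ | end₂ e Fin.≟ x₀
  ... | yes e₁ | _      = inj₁ (end₂ e , inj₁ (e₁ , refl))
  ... | no _   | yes e₂ = inj₁ (end₁ e , inj₂ (refl , e₂))
  ... | no n₁  | no n₂  = inj₂ (n₁ , n₂)

  ends-closed : ∀ {e u v z} → Ends e u v → Closed (p (end₁ e)) (p (end₂ e)) (p z) → Closed (p u) (p v) (p z)
  ends-closed (inj₁ (refl , refl)) cl                  = cl
  ends-closed (inj₂ (refl , refl)) (inj₁ z-in)         = inj₁ (inside-sym z-in)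
  ends-closed (inj₂ (refl , refl)) (inj₂ (inj₁ z≡v))   = inj₂ (inj₂ z≡v)
  ends-closed (inj₂ (refl , refl)) (inj₂ (inj₂ z≡u))   = inj₂ (inj₁ z≡u)

  closed-x₀⇒≤ : ∀ {v z} → Closed (p x₀) (p v) (p z) → z ≢ x₀ → p z ≤ p v
  closed-x₀⇒≤ {v} (inj₁ z-in)        _    = <⇒≤ (inside⇒< z-in (x₀≤p v) ≤-refl)
  closed-x₀⇒≤ (inj₂ (inj₁ z≡x₀))     z≢x₀ = ⊥-elim (z≢x₀ (p-injective z≡x₀))
  closed-x₀⇒≤ (inj₂ (inj₂ z≡v))      _    = ≤-reflexive z≡v

  hub-crossChord : ∀ k {c d} → c ≢ x₀ → p c < p (first k) → p (first k) < p d → CrossChord D x₀ (first k) c d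
  hub-crossChord k c≢x₀ c<f f<d =
    inj₁ ( inj₁ (x₀<p c≢x₀ , c<f)
         , (λ { (inj₁ (_ , d<f)) → <-asym d<f f<d ; (inj₂ (_ , d<x₀)) → <⇒≱ d<x₀ (x₀≤p _) })
         , (λ { refl → <⇒≱ f<d (x₀≤p _) }) , (λ { refl → <-irrefl refl f<d }))

  EdgeOf : Fin m → Edge G → Set
  EdgeOf k e = Consecutive (route k) (end₁ e) (end₂ e) ⊎ Consecutive (route k) (end₂ e) (end₁ e)

  route-edge : ∀ k {u v} (c : Consecutive (route k) u v) → EdgeOf k (edge u v (route-adj k c))
  route-edge k c with edge-ends _ _ (route-adj k c)
  ... | inj₁ (e₁ , e₂) = inj₁ (subst₂ (Consecutive (route k)) (≡.sym e₁) (≡.sym e₂) c)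
  ... | inj₂ (e₁ , e₂) = inj₂ (subst₂ (Consecutive (route k)) (≡.sym e₂) (≡.sym e₁) c)

  edgeOf⇒∈ : ∀ {k e} → EdgeOf k e → end₁ e ∈ route k × end₂ e ∈ route k
  edgeOf⇒∈ (inj₁ c) = consecutive⇒∈ˡ c , consecutive⇒∈ʳ c
  edgeOf⇒∈ (inj₂ c) = consecutive⇒∈ʳ c , consecutive⇒∈ˡ c

  edgeOf⇒interior : ∀ {k e} → EdgeOf k e → Interior k (end₁ e) ⊎ Interior k (end₂ e)
  edgeOf⇒interior (inj₁ c) = consecutive-route⇒interior _ c
  edgeOf⇒interior (inj₂ c) = [ inj₂ , inj₁ ]′ (consecutive-route⇒interior _ c)

  interior-∈-route : ∀ {k k′ z} → Interior k z → z ∈ route k′ → k ≡ k′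
  interior-∈-route {k} {k′} i z∈ with ∈-route⁻ k′ z∈
  ... | inj₁ z≡x₀        = ⊥-elim (interior≢x₀ k i z≡x₀)
  ... | inj₂ (inj₁ i′)   = interior-disjoint k k′ i i′
  ... | inj₂ (inj₂ z≡x₁) = ⊥-elim (interior≢x₁ k i z≡x₁)

  edgeOf-unique : ∀ {k k′ e} → EdgeOf k e → EdgeOf k′ e → k ≡ k′
  edgeOf-unique {k} {k′} {e} of of′ with edgeOf⇒interior {k} {e} of
  ... | inj₁ i = interior-∈-route i (proj₁ (edgeOf⇒∈ {k′} {e} of′))
  ... | inj₂ i = interior-∈-route i (proj₂ (edgeOf⇒∈ {k′} {e} of′))

  hub : Fin m → Edge G
  hub k = edge x₀ (first k) (route-adj k (route-first k))

  hub-ends : ∀ k → Ends (hub k) x₀ (first k)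
  hub-ends k = edge-ends x₀ (first k) (route-adj k (route-first k))

  hub-edgeOf : ∀ k → EdgeOf k (hub k)
  hub-edgeOf k = route-edge k (route-first k)

  module Component (h o : Fin m) (h≢o : h ≢ o) where

    OnPair : Fin m → Set
    OnPair k = k ≡ h ⊎ k ≡ o

    PairEdge : Edge G → Set
    PairEdge e = ∃ λ k → OnPair k × EdgeOf k e

    Step : Edge G → Edge G → Set
    Step e e′ = PairEdge e × PairEdge e′ × Cross D e e′

    Reached : Edge G → Set
    Reached = Star Step (hub h)

    Touched : V → Set
    Touched z = ∃ λ e → Reached e × (z ≡ end₁ e ⊎ z ≡ end₂ e)

    F : V
    F = first h

    reached-step : ∀ {e e′} → Reached e → Step e e′ → Reached e′
    reached-step r s = r ◅◅ (s ◅ ε)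

    reached-pairEdge : ∀ {e} → Reached e → PairEdge e
    reached-pairEdge = go (h , inj₁ refl , hub-edgeOf h)
      where
      go : ∀ {x e} → PairEdge x → Star Step x e → PairEdge e
      go pe ε       = pe
      go _  (s ◅ r) = go (proj₁ (proj₂ s)) r

    Linked : Edge G → Edge G → Set
    Linked e e′ = Reached e × Reached e′ × Cross D e e′

    reached⇒linked : ∀ {e} → Reached e → Star Linked (hub h) e
    reached⇒linked = go ε
      where
      go : ∀ {x e} → Reached x → Star Step x e → Star Linked x e
      go _  ε       = ε
      go rx (s ◅ r) = (rx , reached-step rx s , proj₂ (proj₂ s)) ◅ go (reached-step rx s) r

    reached-induction : (Φ : Edge G → Set) → Φ (hub h) →
                        (∀ {e e′} → Reached e → Reached e′ → Φ e → Cross D e e′ → Φ e′) →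
                        ∀ {e} → Reached e → Φ e
    reached-induction Φ φ-hub step r =
      Star.fold (λ x y → Φ x → Φ y) (λ (rx , ry , c) k φx → k (step rx ry φx c)) id (reached⇒linked r) φ-hub

    touched-end₁ : ∀ {e} → Reached e → Touched (end₁ e)
    touched-end₁ r = _ , r , inj₁ refl

    touched-end₂ : ∀ {e} → Reached e → Touched (end₂ e)
    touched-end₂ r = _ , r , inj₂ refl

    touched-ends : ∀ {e u v} → Reached e → Ends e u v → Touched u × Touched v
    touched-ends r (inj₁ (refl , refl)) = touched-end₁ r , touched-end₂ r
    touched-ends r (inj₂ (refl , refl)) = touched-end₂ r , touched-end₁ r

    touched-from-ends : (Ψ : V → Set) → (∀ {e} → Reached e → Ψ (end₁ e) × Ψ (end₂ e)) → ∀ {z} → Touched z → Ψ z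
    touched-from-ends Ψ ψ (_ , re , inj₁ refl) = proj₁ (ψ re)
    touched-from-ends Ψ ψ (_ , re , inj₂ refl) = proj₂ (ψ re)

    touched-F : Touched F
    touched-F = proj₂ (touched-ends ε (hub-ends h))

    touched-≢ : ∀ {e z} → Reached e → ¬ Touched z → z ≢ end₁ e × z ≢ end₂ e
    touched-≢ r ¬t = (λ { refl → ¬t (touched-end₁ r) }) , (λ { refl → ¬t (touched-end₂ r) })

    touched-crossing : ∀ {e k u v} → Reached e → OnPair k → Consecutive (route k) u v →
                       CrossChord D (end₁ e) (end₂ e) u v → Touched u × Touched v
    touched-crossing {e} {k} {u} {v} r ok c x =
      touched-ends (reached-step {e′ = e′} r (reached-pairEdge r , (k , ok , route-edge k c) ,
                                    crossChord-endsʳ D {e = e′} (edge-ends u v (route-adj k c)) x))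
                   (edge-ends u v (route-adj k c))
      where
      e′ : Edge G
      e′ = edge u v (route-adj k c)

    Separates : V → V → V → V → Set
    Separates c d x y = (Between D c d x × ¬ Between D c d y) ⊎ (¬ Between D c d x × Between D c d y)

    ends-separates : ∀ {e u v x y} → Ends e u v → Separates u v x y → Separates (end₁ e) (end₂ e) x y
    ends-separates (inj₁ (refl , refl)) sep = sep
    ends-separates (inj₂ (refl , refl)) (inj₁ (x-in , ¬y-in)) = inj₁ (inside-sym x-in , ¬y-in ∘ inside-sym)
    ends-separates (inj₂ (refl , refl)) (inj₂ (¬x-in , y-in)) = inj₂ (¬x-in ∘ inside-sym , inside-sym y-in)

    -- A stretch of a pair route running from one side of a reached chord to the other crosses it.
    separated-stretch-touched : ∀ {e k x y} l → Reached e → OnPair k →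
      (∀ {u v} → Consecutive (x ∷ l) u v → Consecutive (route k) u v) →
      (∀ {z} → z ∈ x ∷ l → z ≢ end₁ e × z ≢ end₂ e) →
      y ∈ x ∷ l → Separates (end₁ e) (end₂ e) x y → Any Touched (x ∷ l)
    separated-stretch-touched {e} l re ok stretch ≢ends y∈ = go
      where
      in? : ∀ z → Dec (Between D (end₁ e) (end₂ e) z)
      in? z = inside? (p (end₁ e)) (p (end₂ e)) (p z)
      touched-at : ∀ {u v} → Consecutive _ u v → CrossChord D (end₁ e) (end₂ e) u v → Any Touched _
      touched-at c x = lose (consecutive⇒∈ˡ c) (proj₁ (touched-crossing re ok (stretch c) x))
      go : Separates (end₁ e) (end₂ e) _ _ → Any Touched _
      go (inj₁ (x-in , ¬y-in)) =
        let (u , v , c , u-in , ¬v-in) = discrete-ivt (Between D (end₁ e) (end₂ e)) in? l x-in y∈ ¬y-in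
            (v≢c , v≢d) = ≢ends (consecutive⇒∈ʳ c)
        in touched-at c (inj₁ (u-in , ¬v-in , v≢c , v≢d))
      go (inj₂ (¬x-in , y-in)) =
        let (u , v , c , ¬u-in , ¬¬v-in) = discrete-ivt (¬_ ∘ Between D (end₁ e) (end₂ e)) (¬? ∘ in?) l ¬x-in y∈
                                                         (λ ¬in → ¬in y-in)
            (u≢c , u≢d) = ≢ends (consecutive⇒∈ˡ c)
        in touched-at c (inj₂ (decidable-stable (in? v) ¬¬v-in , ¬u-in , u≢c , u≢d))

    record LastTouched (k : Fin m) : Set where
      field
        before    : List V
        r r⁺      : V
        after     : List V
        split     : onward k ≡ before ++ r ∷ r⁺ ∷ after
        touched   : Touched r
        untouched : All (¬_ ∘ Touched) (r⁺ ∷ after)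
        x₁∈       : x₁ ∈ r⁺ ∷ after
        r-interior : Interior k r

    ¬¬-lastTouched : ∀ k → ¬ Touched x₁ → Any Touched (onward k) → ¬ ¬ LastTouched k
    ¬¬-lastTouched k ¬x₁ t ¬lt = ¬¬-splitAtLast Touched (onward k) t (¬lt ∘ lastTouched)
      where
      x₁-after : ∀ {b r a} → onward k ≡ b ++ r ∷ a → Touched r → x₁ ∈ a
      x₁-after {b} sp t = ∈-after b (interior k) (≡.sym sp) (λ { refl → ¬x₁ t })
      lastTouched : SplitAtLast Touched (onward k) → LastTouched k
      lastTouched record { after = [] ; split = sp ; holds = t } with () ← x₁-after sp t
      lastTouched record { before = b ; last = r ; after = r⁺ ∷ a ; split = sp ; holds = t ; fails = f } =
        record { before = b ; r = r ; r⁺ = r⁺ ; after = a ; split = sp ; touched = t ; untouched = f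
               ; x₁∈ = x₁-after sp t ; r-interior = r-interior }
        where
        r-interior : Interior k r
        r-interior with ∈-onward⁻ k (subst (r ∈_) (≡.sym sp) (∈-++⁺ʳ b (here refl)))
        ... | inj₁ i    = i
        ... | inj₂ refl = ⊥-elim (¬x₁ t)

    -- The route beyond its last touched vertex r crosses no reached chord, so it stays on
    -- one side of each of them, and so does r unless it is an endpoint.
    module AfterLastTouched {k} (ok : OnPair k) (lt : LastTouched k) where
      open LastTouched lt

      r-r⁺ : Consecutive (route k) r r⁺
      r-r⁺ = there (subst (λ L → Consecutive L r r⁺) (≡.sym split) (consecutive-++⁺ʳ before here))

      after-route : ∀ {u v} → Consecutive (r⁺ ∷ after) u v → Consecutive (route k) u v
      after-route c = there (subst (λ L → Consecutive L _ _) (≡.sym split′)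
                                   (consecutive-++⁺ʳ (before ++ r ∷ []) c))
        where
        split′ : onward k ≡ (before ++ r ∷ []) ++ r⁺ ∷ after
        split′ = ≡.trans split (≡.sym (++-assoc before (r ∷ []) (r⁺ ∷ after)))

      untouched-after : ∀ {z} → z ∈ r⁺ ∷ after → ¬ Touched z
      untouched-after = All.lookup untouched

      module _ {e : Edge G} (re : Reached e) where
        private
          c d : V
          c = end₁ e
          d = end₂ e

          ≢ends : ∀ {z} → z ∈ r⁺ ∷ after → z ≢ c × z ≢ d
          ≢ends z∈ = touched-≢ re (untouched-after z∈)

          ¬separated : ¬ Separates c d r⁺ x₁
          ¬separated sep = All¬⇒¬Any untouched (separated-stretch-touched after re ok after-route ≢ends x₁∈ sep)

        r⁺-inside⇒x₁-inside : Between D c d r⁺ → Between D c d x₁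
        r⁺-inside⇒x₁-inside r⁺-in = decidable-stable (inside? (p c) (p d) (p x₁)) λ ¬x₁-in →
          ¬separated (inj₁ (r⁺-in , ¬x₁-in))

        x₁-inside⇒r⁺-inside : Between D c d x₁ → Between D c d r⁺
        x₁-inside⇒r⁺-inside x₁-in = decidable-stable (inside? (p c) (p d) (p r⁺)) λ ¬r⁺-in →
          ¬separated (inj₂ (¬r⁺-in , x₁-in))

        ¬crossing-r-r⁺ : ¬ CrossChord D c d r r⁺
        ¬crossing-r-r⁺ x = untouched-after (here refl) (proj₂ (touched-crossing re ok r-r⁺ x))

        r-inside⇒x₁-inside : Between D c d r → Between D c d x₁
        r-inside⇒x₁-inside r-in with inside? (p c) (p d) (p r⁺)
        ... | yes r⁺-in = r⁺-inside⇒x₁-inside r⁺-in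
        ... | no ¬r⁺-in = let (r⁺≢c , r⁺≢d) = ≢ends (here refl) in
                          ⊥-elim (¬crossing-r-r⁺ (inj₁ (r-in , ¬r⁺-in , r⁺≢c , r⁺≢d)))

        x₁-inside⇒r-closed : Between D c d x₁ → Closed (p c) (p d) (p r)
        x₁-inside⇒r-closed x₁-in with inside? (p c) (p d) (p r) | r Fin.≟ c | r Fin.≟ d
        ... | yes r-in | _        | _        = inj₁ r-in
        ... | no _     | yes refl | _        = inj₂ (inj₁ refl)
        ... | no _     | no _     | yes refl = inj₂ (inj₂ refl)
        ... | no ¬r-in | no r≢c   | no r≢d   =
          ⊥-elim (¬crossing-r-r⁺ (inj₂ (x₁-inside⇒r⁺-inside x₁-in , ¬r-in , r≢c , r≢d)))

    touched-onward-h : Any Touched (onward h)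
    touched-onward-h = lose (subst (λ L → F ∈ L ∷ʳ x₁) (≡.sym (proj₂ (interior-≡ h))) (here refl)) touched-F

    touched-onward-o : Separates x₀ F (first o) x₁ → Any Touched (onward o)
    touched-onward-o sep = subst (Any Touched) (≡.sym onward-≡)
      (separated-stretch-touched (l ∷ʳ x₁) ε (inj₂ refl) (there ∘ subst (λ L → Consecutive L _ _) (≡.sym onward-≡))
        (λ {z} z∈ → ends-both {hub h} (z ≢_) (hub-ends h) (proj₁ (≢hub z∈)) (proj₂ (≢hub z∈)))
        (subst (x₁ ∈_) onward-≡ (x₁∈onward o))
        (ends-separates {hub h} (hub-ends h) sep))
      where
      l : List V
      l = proj₁ (interior-≡ o)
      onward-≡ : onward o ≡ first o ∷ (l ∷ʳ x₁)
      onward-≡ = cong (_∷ʳ x₁) (proj₂ (interior-≡ o))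
      ≢hub : ∀ {z} → z ∈ first o ∷ (l ∷ʳ x₁) → z ≢ x₀ × z ≢ F
      ≢hub z∈ with ∈-onward⁻ o (subst (_ ∈_) (≡.sym onward-≡) z∈)
      ... | inj₁ i    = interior≢x₀ o i , λ { refl → h≢o (interior-disjoint h o (first-interior h) i) }
      ... | inj₂ refl = x₀≢x₁ ∘ ≡.sym , interior≢x₁ h (first-interior h) ∘ ≡.sym

    -- No reached chord contains r, as it would contain x₁ too; so none passes over r.
    lastTouched-rightmost : (∀ {w} → Touched w → p w < p x₁) →
                            ∀ {k} → OnPair k → (lt : LastTouched k) → ∀ {z} → Touched z → p z ≤ p (LastTouched.r lt)
    lastTouched-rightmost left-of-x₁ {k} ok lt = touched-from-ends (λ z → p z ≤ p r) below
      where
      open LastTouched lt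
      open AfterLastTouched ok lt
      r-outside : ∀ {e} → Reached e → ¬ Between D (end₁ e) (end₂ e) r
      r-outside re r-in = <-irrefl refl (inside⇒< (r-inside⇒x₁-inside re r-in)
        (<⇒≤ (left-of-x₁ (touched-end₁ re))) (<⇒≤ (left-of-x₁ (touched-end₂ re))))
      F≤r : p F ≤ p r
      F≤r = ≮⇒≥ λ r<F → r-outside ε (ends-inside {hub h} (hub-ends h) (inj₁ (x₀<p (interior≢x₀ k r-interior) , r<F)))
      below : ∀ {e} → Reached e → p (end₁ e) ≤ p r × p (end₂ e) ≤ p r
      below = reached-induction (λ e → p (end₁ e) ≤ p r × p (end₂ e) ≤ p r)
        (ends-both {hub h} (λ z → p z ≤ p r) (hub-ends h) (x₀≤p r) F≤r)
        (λ _ re′ (l₁ , l₂) x → interleaved-≤ l₁ l₂ (r-outside re′) (crossChord⇒interleaved D x))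

    -- Otherwise the last touched vertices of both routes would be the rightmost touched vertex.
    ¬¬-touched-beyond-x₁ : p (first o) < p F → p F < p x₁ → ¬ ¬ ∃ λ w → Touched w × p x₁ ≤ p w
    ¬¬-touched-beyond-x₁ o<F F<x₁ ¬beyond =
      ¬¬-lastTouched h ¬x₁ touched-onward-h λ lh →
      ¬¬-lastTouched o ¬x₁ (touched-onward-o (inj₁ (o-inside , x₁-outside))) λ lo →
      let open LastTouched
          r≡r = p-injective (≤-antisym (lastTouched-rightmost left-of-x₁ (inj₁ refl) lh (touched lo))
                                        (lastTouched-rightmost left-of-x₁ (inj₂ refl) lo (touched lh)))
      in h≢o (interior-disjoint h o (r-interior lh) (subst (Interior o) r≡r (r-interior lo)))
      where
      left-of-x₁ : ∀ {w} → Touched w → p w < p x₁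
      left-of-x₁ t = ≰⇒> λ x₁≤w → ¬beyond (_ , t , x₁≤w)
      ¬x₁ : ¬ Touched x₁
      ¬x₁ t = <-irrefl refl (left-of-x₁ t)
      o-inside : Between D x₀ F (first o)
      o-inside = inj₁ (x₀<p (interior≢x₀ o (first-interior o)) , o<F)
      x₁-outside : ¬ Between D x₀ F x₁
      x₁-outside (inj₁ (_ , x₁<F))  = <-asym x₁<F F<x₁
      x₁-outside (inj₂ (_ , x₁<x₀)) = <-asym x₁<x₀ x₀<x₁

    record Frontier (s : V) : Set where
      field
        uncovered : ∀ {e} → Reached e → end₁ e ≢ x₀ → end₂ e ≢ x₀ → ¬ Between D (end₁ e) (end₂ e) s
        spanned   : ∀ {e v} → Reached e → Ends e x₀ v → p s ≤ p v

    -- The reached edges away from x₀ and left of s would be closed under crossings within the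
    -- component, which is connected and contains the hub at x₀.
    frontier-leftmost : ∀ {r s} → Touched r → r ≢ x₀ → Frontier s → ¬ p r < p s
    frontier-leftmost {r} {s} (_ , re , r-end) r≢x₀ fr r<s = ¬left re (left-of re r≢x₀ r<s r-end)
      where
      open Frontier fr
      LeftOf : Edge G → Set
      LeftOf e = end₁ e ≢ x₀ × end₂ e ≢ x₀ × p (end₁ e) ≤ p s × p (end₂ e) ≤ p s
      closed : ∀ {v z} → p s ≤ p v → z ≢ x₀ → p z ≤ p s → Closed (p x₀) (p v) (p z)
      closed s≤v z≢x₀ z≤s = ≤⇒closed (x₀<p z≢x₀) (≤-trans z≤s s≤v)
      left-crossed : ∀ {e e′} → Reached e′ → LeftOf e → Cross D e e′ → LeftOf e′
      left-crossed {e} {e′} re′ (n₁ , n₂ , l₁ , l₂) x with x₀-end? e′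
      ... | inj₁ (v , ends) =
        ⊥-elim (closed⇒¬interleaved (closed (spanned re′ ends) n₁ l₁) (closed (spanned re′ ends) n₂ l₂)
                  (crossChord⇒interleaved D (crossChord-endsˡ⁻ D {e = e′} ends (crossChord-sym D x))))
      ... | inj₂ (m₁ , m₂) =
        let (l₁′ , l₂′) = interleaved-≤ l₁ l₂ (uncovered re′ m₁ m₂) (crossChord⇒interleaved D x)
        in m₁ , m₂ , l₁′ , l₂′
      hub-¬left : ¬ LeftOf (hub h)
      hub-¬left (n₁ , n₂ , _) = [ n₁ ∘ proj₁ , n₂ ∘ proj₂ ]′ (hub-ends h)
      ¬left : ∀ {e} → Reached e → ¬ LeftOf e
      ¬left = reached-induction (¬_ ∘ LeftOf) hub-¬left
        (λ {e} {e′} re re′ ¬l x l′ → ¬l (left-crossed {e′} {e} re l′ (crossChord-sym D {a = end₁ e} {b = end₂ e} x)))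
      left-of : ∀ {e z} → Reached e → z ≢ x₀ → p z < p s → z ≡ end₁ e ⊎ z ≡ end₂ e → LeftOf e
      left-of {e} re z≢x₀ z<s (inj₁ refl) with end₂ e Fin.≟ x₀
      ... | yes e₂ = ⊥-elim (<⇒≱ z<s (spanned re (inj₂ (refl , e₂))))
      ... | no n₂  = z≢x₀ , n₂ , <⇒≤ z<s , ≮⇒≥ (λ s<d → uncovered re z≢x₀ n₂ (inj₁ (z<s , s<d)))
      left-of {e} re z≢x₀ z<s (inj₂ refl) with end₁ e Fin.≟ x₀
      ... | yes e₁ = ⊥-elim (<⇒≱ z<s (spanned re (inj₁ (e₁ , refl))))
      ... | no n₁  = n₁ , z≢x₀ , ≮⇒≥ (λ s<c → uncovered re n₁ z≢x₀ (inj₂ (z<s , s<c))) , <⇒≤ z<s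

    frontier-unique : ∀ {r s} → Touched r → Touched s → r ≢ x₀ → s ≢ x₀ → Frontier r → Frontier s → r ≡ s
    frontier-unique {r} {s} tr ts r≢x₀ s≢x₀ fr fs with <-cmp (p r) (p s)
    ... | tri< r<s _ _ = ⊥-elim (frontier-leftmost tr r≢x₀ fs r<s)
    ... | tri≈ _ r≡s _ = p-injective r≡s
    ... | tri> _ _ s<r = ⊥-elim (frontier-leftmost ts s≢x₀ fr s<r)

    lastTouched-frontier : (∀ {w} → Touched w → w ≢ x₀ → p x₁ < p w) →
                           ∀ {k} → OnPair k → (lt : LastTouched k) → Frontier (LastTouched.r lt)
    lastTouched-frontier right-of-x₁ {k} ok lt = record { uncovered = uncovered ; spanned = spanned }
      where
      open LastTouched lt
      open AfterLastTouched ok lt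
      uncovered : ∀ {e} → Reached e → end₁ e ≢ x₀ → end₂ e ≢ x₀ → ¬ Between D (end₁ e) (end₂ e) r
      uncovered re n₁ n₂ r-in = <-irrefl refl (inside⇒> (r-inside⇒x₁-inside re r-in)
        (<⇒≤ (right-of-x₁ (touched-end₁ re) n₁)) (<⇒≤ (right-of-x₁ (touched-end₂ re) n₂)))
      spanned : ∀ {e v} → Reached e → Ends e x₀ v → p r ≤ p v
      spanned {e} {v} re ends =
        closed-x₀⇒≤ (ends-closed {e} ends (x₁-inside⇒r-closed re x₁-inside)) (interior≢x₀ k r-interior)
        where
        x₁-inside : Between D (end₁ e) (end₂ e) x₁
        x₁-inside = ends-inside {e} ends
          (inj₁ (x₀<x₁ , right-of-x₁ (proj₂ (touched-ends re ends)) (ends-≢ {e} ends ∘ ≡.sym)))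

    -- Otherwise the last touched vertices of both routes would be the leftmost frontier vertex.
    ¬¬-touched-left-of-x₁ : p x₁ < p F → p F < p (first o) → ¬ ¬ ∃ λ w → Touched w × p x₀ < p w × p w ≤ p x₁
    ¬¬-touched-left-of-x₁ x₁<F F<o ¬left =
      ¬¬-lastTouched h ¬x₁ touched-onward-h λ lh →
      ¬¬-lastTouched o ¬x₁ (touched-onward-o (inj₂ (o-outside , x₁-inside))) λ lo →
      let open LastTouched
          r≡r = frontier-unique (touched lh) (touched lo) (interior≢x₀ h (r-interior lh)) (interior≢x₀ o (r-interior lo))
                  (lastTouched-frontier right-of-x₁ (inj₁ refl) lh) (lastTouched-frontier right-of-x₁ (inj₂ refl) lo)
      in h≢o (interior-disjoint h o (r-interior lh) (subst (Interior o) (≡.sym r≡r) (r-interior lo)))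
      where
      right-of-x₁ : ∀ {w} → Touched w → w ≢ x₀ → p x₁ < p w
      right-of-x₁ t w≢x₀ = ≰⇒> λ w≤x₁ → ¬left (_ , t , x₀<p w≢x₀ , w≤x₁)
      ¬x₁ : ¬ Touched x₁
      ¬x₁ t = <-irrefl refl (right-of-x₁ t (x₀≢x₁ ∘ ≡.sym))
      o-outside : ¬ Between D x₀ F (first o)
      o-outside (inj₁ (_ , o<F))  = <-asym o<F F<o
      o-outside (inj₂ (_ , o<x₀)) = <-asym o<x₀ (x₀<p (interior≢x₀ o (first-interior o)))
      x₁-inside : Between D x₀ F x₁
      x₁-inside = inj₁ (x₀<x₁ , x₁<F)

    module _ (h′ : Fin m) (h′≢h : h′ ≢ h) (h′≢o : h′ ≢ o) where

      F′ : V
      F′ = first h′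

      CrossesHub′ : Set
      CrossesHub′ = ∃ λ e → Reached e × Cross D e (hub h′)

      reached-≢F′ : ∀ {e c d} → Reached e → Ends e c d → c ≢ F′ × d ≢ F′
      reached-≢F′ {e} re ends with reached-pairEdge re
      ... | k , ok , of =
        ends-both⁻ {e} (_≢ F′) ends (≢F′ (proj₁ (edgeOf⇒∈ {k} {e} of))) (≢F′ (proj₂ (edgeOf⇒∈ {k} {e} of)))
        where
        k≢h′ : k ≢ h′
        k≢h′ refl = [ h′≢h , h′≢o ]′ ok
        ≢F′ : ∀ {z} → z ∈ route k → z ≢ F′
        ≢F′ z∈ refl = k≢h′ (≡.sym (interior-∈-route (first-interior h′) z∈))

      straddling-crossesHub′ : ∀ {e c d} → Reached e → Ends e c d → c ≢ x₀ →
                               p c < p F′ → p F′ < p d → CrossesHub′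
      straddling-crossesHub′ {e} re ends c≢x₀ c<F′ F′<d = e , re , crossChord-endsʳ D {e = hub h′} (hub-ends h′)
        (crossChord-endsˡ D {e = e} ends (crossChord-sym D (hub-crossChord h′ c≢x₀ c<F′ F′<d)))

      crossesHub′-or-left : ∀ {e c d} → Reached e → Ends e c d → c ≢ x₀ → p c < p F′ → CrossesHub′ ⊎ p d < p F′
      crossesHub′-or-left {e} {c} {d} re ends c≢x₀ c<F′ with d Fin.≟ x₀ | <-cmp (p d) (p F′)
      ... | yes refl | _          = inj₂ (<-trans (x₀<p c≢x₀) c<F′)
      ... | no _     | tri< d<F′ _ _ = inj₂ d<F′
      ... | no _     | tri≈ _ q _ = ⊥-elim (proj₂ (reached-≢F′ re ends) (p-injective q))
      ... | no _     | tri> _ _ F′<d = inj₁ (straddling-crossesHub′ re ends c≢x₀ c<F′ F′<d)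

      -- Otherwise the reached chords would stay within [x₀, F′].
      ¬¬-crossesHub′-from-left : p F < p F′ → p F′ < p x₁ → (∃ λ w → Touched w × p x₁ ≤ p w) → ¬ ¬ CrossesHub′
      ¬¬-crossesHub′-from-left F<F′ F′<x₁ (w , tw , x₁≤w) ¬crosses =
        <-irrefl refl (<-≤-trans (≤-<-trans (touched-from-ends (λ z → p z ≤ p F′) within tw) F′<x₁) x₁≤w)
        where
        Within : Edge G → Set
        Within e = p (end₁ e) ≤ p F′ × p (end₂ e) ≤ p F′
        closed : ∀ {v z} → p z ≤ p F′ → p F′ < p v → Closed (p x₀) (p v) (p z)
        closed {z = z} z≤F′ F′<v with z Fin.≟ x₀
        ... | yes refl  = inj₂ (inj₁ refl)
        ... | no z≢x₀   = inj₁ (inj₁ (x₀<p z≢x₀ , ≤-<-trans z≤F′ F′<v))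
        at-x₀ : ∀ {e e′ v} → Within e → Ends e′ x₀ v → Cross D e e′ → p v ≤ p F′
        at-x₀ {e′ = e′} (l₁ , l₂) ends x = ≮⇒≥ λ F′<v → closed⇒¬interleaved (closed l₁ F′<v) (closed l₂ F′<v)
          (crossChord⇒interleaved D (crossChord-endsˡ⁻ D {e = e′} ends (crossChord-sym D x)))
        within-crossed : ∀ {e e′} → Reached e′ → Within e → Cross D e e′ → Within e′
        within-crossed {e} {e′} re′ we x with x₀-end? e′
        ... | inj₁ (v , ends) = ends-both {e′} (λ z → p z ≤ p F′) ends (x₀≤p F′) (at-x₀ {e} {e′} we ends x)
        ... | inj₂ (n₁ , n₂)
          with reached-≢F′ re′ (inj₁ (refl , refl)) | <-cmp (p (end₁ e′)) (p F′) | <-cmp (p (end₂ e′)) (p F′)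
        ...   | f₁ , _ | tri≈ _ q _ | _          = ⊥-elim (f₁ (p-injective q))
        ...   | _ , f₂ | _          | tri≈ _ q _ = ⊥-elim (f₂ (p-injective q))
        ...   | _      | tri< a _ _ | tri< b _ _ = <⇒≤ a , <⇒≤ b
        ...   | _      | tri< a _ _ | tri> _ _ b = ⊥-elim (¬crosses (straddling-crossesHub′ re′ (inj₁ (refl , refl)) n₁ a b))
        ...   | _      | tri> _ _ a | tri< b _ _ = ⊥-elim (¬crosses (straddling-crossesHub′ re′ (inj₂ (refl , refl)) n₂ b a))
        ...   | _      | tri> _ _ a | tri> _ _ b = ⊥-elim (¬inside⇒¬interleaved
          (λ q → <⇒≱ (inside⇒> q (<⇒≤ a) (<⇒≤ b)) (proj₁ we))
          (λ q → <⇒≱ (inside⇒> q (<⇒≤ a) (<⇒≤ b)) (proj₂ we))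
          (interleaved-sym (crossChord⇒interleaved D x)))
        within : ∀ {e} → Reached e → Within e
        within = reached-induction Within (ends-both {hub h} (λ z → p z ≤ p F′) (hub-ends h) (x₀≤p F′) (<⇒≤ F<F′))
          (λ {e} {e′} _ re′ we x → within-crossed {e} {e′} re′ we x)

      -- Otherwise every touched vertex but x₀ would lie right of F′.
      ¬¬-crossesHub′-from-right : p F′ < p F → p x₁ < p F′ →
                                  (∃ λ w → Touched w × p x₀ < p w × p w ≤ p x₁) → ¬ ¬ CrossesHub′
      ¬¬-crossesHub′-from-right F′<F x₁<F′ (w , tw , x₀<w , w≤x₁) ¬crosses =
        [ (λ { refl → <-irrefl refl x₀<w }) , (λ F′<w → <-irrefl refl (<-trans (<-≤-trans F′<w w≤x₁) x₁<F′)) ]′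
          (touched-from-ends Outer outer tw)
        where
        Outer : V → Set
        Outer z = z ≡ x₀ ⊎ p F′ < p z
        left-of-F′ : ∀ {e c d} → Reached e → Ends e c d → ¬ Outer c → p c < p F′ × p d < p F′
        left-of-F′ {e} {c} re ends ¬oc =
          c<F′ , [ ⊥-elim ∘ ¬crosses , id ]′ (crossesHub′-or-left re ends (¬oc ∘ inj₁) c<F′)
          where
          c<F′ : p c < p F′
          c<F′ = ≤∧≢⇒< (≮⇒≥ (¬oc ∘ inj₂)) (proj₁ (reached-≢F′ re ends) ∘ p-injective)
        outer-¬inside : ∀ {c d z} → p c < p F′ → p d < p F′ → Outer z → ¬ Between D c d z
        outer-¬inside _   _   (inj₁ refl) = x₀-¬inside
        outer-¬inside c<F′ d<F′ (inj₂ F′<z) z-in = <-asym F′<z (inside⇒< z-in (<⇒≤ c<F′) (<⇒≤ d<F′))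
        outer? : ∀ z → Dec (Outer z)
        outer? z with z Fin.≟ x₀ | p F′ <? p z
        ... | yes z≡x₀ | _        = yes (inj₁ z≡x₀)
        ... | no _     | yes F′<z = yes (inj₂ F′<z)
        ... | no z≢x₀  | no F′≮z  = no [ z≢x₀ , F′≮z ]′
        left-¬crossed : ∀ {e e′} → Outer (end₁ e) × Outer (end₂ e) → p (end₁ e′) < p F′ × p (end₂ e′) < p F′ →
                        ¬ Cross D e e′
        left-¬crossed (o₁ , o₂) (l₁ , l₂) x = ¬inside⇒¬interleaved (outer-¬inside l₁ l₂ o₁) (outer-¬inside l₁ l₂ o₂)
          (interleaved-sym (crossChord⇒interleaved D x))
        outer-crossed : ∀ {e e′} → Reached e′ → Outer (end₁ e) × Outer (end₂ e) → Cross D e e′ →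
                        Outer (end₁ e′) × Outer (end₂ e′)
        outer-crossed {e} {e′} re′ oe x with outer? (end₁ e′) | outer? (end₂ e′)
        ... | yes a | yes b = a , b
        ... | no ¬a | _     = ⊥-elim (left-¬crossed {e} {e′} oe (left-of-F′ re′ (inj₁ (refl , refl)) ¬a) x)
        ... | yes _ | no ¬b = ⊥-elim (left-¬crossed {e} {e′} oe (swap (left-of-F′ re′ (inj₂ (refl , refl)) ¬b)) x)
        outer : ∀ {e} → Reached e → Outer (end₁ e) × Outer (end₂ e)
        outer = reached-induction (λ e → Outer (end₁ e) × Outer (end₂ e))
          (ends-both {hub h} Outer (hub-ends h) (inj₁ refl) (inj₂ F′<F))
          (λ {e} {e′} _ re′ oe x → outer-crossed {e} {e′} re′ oe x)


-- Pigeonhole for 2-colourings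

record Monochromatic {m : ℕ} (c : Fin m → Bool) (b : Bool) (k : ℕ) : Set where
  field
    embed           : Fin k → Fin m
    embed-injective : ∀ {i j} → embed i ≡ embed j → i ≡ j
    embed-colour    : ∀ i → c (embed i) ≡ b

module _ {m : ℕ} {c : Fin (suc m) → Bool} {b : Bool} {k : ℕ} (M : Monochromatic (c ∘ suc) b k) where
  open Monochromatic M

  monochromatic-suc : Monochromatic c b k
  monochromatic-suc = record
    { embed = suc ∘ embed ; embed-injective = embed-injective ∘ Fin.suc-injective ; embed-colour = embed-colour }

  monochromatic-∷ : c zero ≡ b → Monochromatic c b (suc k)
  monochromatic-∷ c₀ = record { embed = embed′ ; embed-injective = injective ; embed-colour = colour }
    where
    embed′ : Fin (suc k) → Fin (suc m)
    embed′ zero    = zero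
    embed′ (suc i) = suc (embed i)
    injective : ∀ {i j} → embed′ i ≡ embed′ j → i ≡ j
    injective {zero}  {zero}  _  = refl
    injective {suc i} {suc j} eq = cong suc (embed-injective (Fin.suc-injective eq))
    colour : ∀ i → c (embed′ i) ≡ b
    colour zero    = c₀
    colour (suc i) = embed-colour i

monochromatic-≤ : ∀ {m} {c : Fin m → Bool} {b k k′} → k ≤ k′ → Monochromatic c b k′ → Monochromatic c b k
monochromatic-≤ k≤k′ M = record
  { embed           = embed ∘ (λ i → inject≤ i k≤k′)
  ; embed-injective = λ eq → Fin.inject≤-injective k≤k′ k≤k′ _ _ (embed-injective eq)
  ; embed-colour    = λ i → embed-colour _ }
  where open Monochromatic M

colour-classes : ∀ m (c : Fin m → Bool) →
                 ∃₂ λ a b → a + b ≡ m × Monochromatic c true a × Monochromatic c false b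
colour-classes zero    c = 0 , 0 , refl , empty , empty
  where
  empty : ∀ {b} → Monochromatic c b 0
  empty = record { embed = λ () ; embed-injective = λ { {()} } ; embed-colour = λ () }
colour-classes (suc m) c with colour-classes m (c ∘ suc) | c zero in c₀
... | a , b , a+b , Mt , Mf | true  =
  suc a , b , cong suc a+b , monochromatic-∷ Mt c₀ , monochromatic-suc Mf
... | a , b , a+b , Mt , Mf | false =
  a , suc b , ≡.trans (+-suc a b) (cong suc a+b) , monochromatic-suc Mt , monochromatic-∷ Mf c₀

pigeonhole-half : ∀ {m} k → k + k ≡ m → (c : Fin m → Bool) → ∃ λ b → Monochromatic c b k
pigeonhole-half {m} k k+k c with colour-classes m c
... | a , b , a+b , Mt , Mf with k ≤? a
...   | yes k≤a = true , monochromatic-≤ k≤a Mt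
...   | no k≰a  = false , monochromatic-≤ k≤b Mf
  where
  k≤b : k ≤ b
  k≤b = ≮⇒≥ λ b<k → <-irrefl (≡.trans a+b (≡.sym k+k)) (+-mono-< (≰⇒> k≰a) b<k)

record OneSidedPairs {m : ℕ} (t : ℕ) (f : Fin m → ℕ) (B : ℕ) : Set where
  field
    near far       : Fin t → Fin m
    pairs-disjoint : ∀ {i j k} → (k ≡ near i ⊎ k ≡ far i) → (k ≡ near j ⊎ k ≡ far j) → i ≡ j
    one-side       : (∀ i → f (far i) < f (near i) × f (near i) < B)
                   ⊎ (∀ i → B < f (near i) × f (near i) < f (far i))

module _ {m : ℕ} (t : ℕ) (f : Fin m → ℕ) (B : ℕ)
         (f-injective : ∀ {j k} → f j ≡ f k → j ≡ k) (f≢B : ∀ k → f k ≢ B) where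

  private
    colour : Fin m → Bool
    colour k with f k <? B
    ... | yes _ = true
    ... | no _  = false

    colour-true : ∀ {k} → colour k ≡ true → f k < B
    colour-true {k} c with f k <? B
    colour-true _  | yes fk<B = fk<B
    colour-true () | no _

    colour-false : ∀ {k} → colour k ≡ false → B < f k
    colour-false {k} c with f k <? B
    colour-false ()    | yes _
    colour-false {k} _ | no fk≮B = ≤∧≢⇒< (≮⇒≥ fk≮B) (f≢B k ∘ ≡.sym)

    module Couples {b : Bool} (M : Monochromatic colour b (t + t)) where
      open Monochromatic M

      InCouple : Fin t → Fin m → Set
      InCouple i k = k ≡ embed (i ↑ˡ t) ⊎ k ≡ embed (t ↑ʳ i)

      ↑ˡ≢↑ʳ : ∀ {i j : Fin t} → i ↑ˡ t ≢ t ↑ʳ j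
      ↑ˡ≢↑ʳ {i} {j} e with ≡.trans (≡.sym (Fin.splitAt-↑ˡ t i t)) (≡.trans (cong (splitAt t) e) (Fin.splitAt-↑ʳ t t j))
      ... | ()

      inCouple-unique : ∀ {i j k} → InCouple i k → InCouple j k → i ≡ j
      inCouple-unique {i} {j} (inj₁ refl) (inj₁ e) = Fin.↑ˡ-injective t i j (embed-injective e)
      inCouple-unique         (inj₁ refl) (inj₂ e) = ⊥-elim (↑ˡ≢↑ʳ (embed-injective e))
      inCouple-unique         (inj₂ refl) (inj₁ e) = ⊥-elim (↑ˡ≢↑ʳ (embed-injective (≡.sym e)))
      inCouple-unique {i} {j} (inj₂ refl) (inj₂ e) = Fin.↑ʳ-injective t i j (embed-injective e)

      inCouple-colour : ∀ {i k} → InCouple i k → colour k ≡ b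
      inCouple-colour (inj₁ refl) = embed-colour _
      inCouple-colour (inj₂ refl) = embed-colour _

      record Ordered (i : Fin t) : Set where
        field
          lo hi : Fin m
          lo<hi : f lo < f hi
          lo-in : InCouple i lo
          hi-in : InCouple i hi

      ordered : ∀ i → Ordered i
      ordered i with <-cmp (f (embed (i ↑ˡ t))) (f (embed (t ↑ʳ i)))
      ... | tri< l _ _ = record { lo<hi = l ; lo-in = inj₁ refl ; hi-in = inj₂ refl }
      ... | tri≈ _ e _ = ⊥-elim (↑ˡ≢↑ʳ (embed-injective (f-injective e)))
      ... | tri> _ _ g = record { lo<hi = g ; lo-in = inj₂ refl ; hi-in = inj₁ refl }

      ordered-inCouple : ∀ i {k} → k ≡ Ordered.hi (ordered i) ⊎ k ≡ Ordered.lo (ordered i) → InCouple i k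
      ordered-inCouple i (inj₁ refl) = Ordered.hi-in (ordered i)
      ordered-inCouple i (inj₂ refl) = Ordered.lo-in (ordered i)

    oneSided : ∀ {b} → Monochromatic colour b (t + t) → OneSidedPairs t f B
    oneSided {true} M = record
      { near = Ordered.hi ∘ ordered ; far = Ordered.lo ∘ ordered
      ; pairs-disjoint = λ {i} {j} p q → inCouple-unique (ordered-inCouple i p) (ordered-inCouple j q)
      ; one-side = inj₁ λ i → let open Ordered (ordered i) in lo<hi , colour-true (inCouple-colour hi-in) }
      where open Couples M
    oneSided {false} M = record
      { near = Ordered.lo ∘ ordered ; far = Ordered.hi ∘ ordered
      ; pairs-disjoint = λ {i} {j} p q → inCouple-unique (ordered-inCouple i (⊎-swap p)) (ordered-inCouple j (⊎-swap q))
      ; one-side = inj₂ λ i → let open Ordered (ordered i) in colour-false (inCouple-colour lo-in) , lo<hi }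
      where open Couples M

  oneSidedPairs : (t + t) + (t + t) ≡ m → OneSidedPairs t f B
  oneSidedPairs eq = oneSided (proj₂ (pigeonhole-half (t + t) eq colour))


-- The clique minor in the crossing graph

¬¬-∀-Fin : ∀ k {P : Fin k → Set} → (∀ i → ¬ ¬ P i) → ¬ ¬ (∀ i → P i)
¬¬-∀-Fin zero    _   k = k λ ()
¬¬-∀-Fin (suc k) ¬¬P c = ¬¬P zero λ p₀ → ¬¬-∀-Fin k (¬¬P ∘ suc) λ ps → c λ { zero → p₀ ; (suc i) → ps i }

2t+2t≡4t : ∀ t → (t + t) + (t + t) ≡ 4 * t
2t+2t≡4t t = ≡.trans (+-assoc t t (t + t)) (cong (λ x → t + (t + (t + x))) (≡.sym (+-identityʳ t)))

module CliqueMinor {t : ℕ} {G : Graph} (D : CircularDrawing G) (T : TopMinorK2 G (4 * t))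
                   (R : LeftmostRedrawing D (TopMinorK2.x T zero)) where

  open LeftmostRedrawing R using (drawing; leftmost; crossChord⁻)
  open Leftmost T drawing leftmost

  first-injective : ∀ {j k} → p (first j) ≡ p (first k) → j ≡ k
  first-injective {j} {k} e =
    interior-disjoint j k (first-interior j) (subst (Interior k) (≡.sym (p-injective e)) (first-interior k))

  first≢x₁ : ∀ k → p (first k) ≢ p x₁
  first≢x₁ k = interior≢x₁ k (first-interior k) ∘ p-injective

  -- Kept opaque so that the type checker never unfolds the pigeonhole construction.
  opaque
    pairs : OneSidedPairs t (p ∘ first) (p x₁)
    pairs = oneSidedPairs t (p ∘ first) (p x₁) first-injective first≢x₁ (2t+2t≡4t t)

  open OneSidedPairs pairs

  near≢far : ∀ i → near i ≢ far i
  near≢far i e with one-side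
  ... | inj₁ left  = <-irrefl (cong (p ∘ first) (≡.sym e)) (proj₁ (left i))
  ... | inj₂ right = <-irrefl (cong (p ∘ first) e) (proj₂ (right i))

  module Branch (i : Fin t) = Component (near i) (far i) (near≢far i)

  branch : Fin t → Edge G → Set
  branch = Branch.Reached

  BranchLink : Fin t → Edge G → Edge G → Set
  BranchLink i e e′ = branch i e × branch i e′ × Cross D e e′

  Adjacent : Fin t → Fin t → Set
  Adjacent i j = ∃₂ λ e e′ → branch i e × branch j e′ × Cross D e e′

  branch-disjoint : ∀ i j e → i ≢ j → branch i e → ¬ branch j e
  branch-disjoint i j e i≢j bi bj with Branch.reached-pairEdge i bi | Branch.reached-pairEdge j bj
  ... | k , ok , of | k′ , ok′ , of′ =
    i≢j (pairs-disjoint ok (subst (λ k → k ≡ near j ⊎ k ≡ far j) (≡.sym (edgeOf-unique {k} {k′} {e} of of′)) ok′))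

  branch-connected : ∀ i e e′ → branch i e → branch i e′ → Star (BranchLink i) e e′
  branch-connected i e e′ be be′ =
    Star.map to-D (Star.reverse (λ (r , r′ , x) → r′ , r , crossChord-sym drawing x) (Branch.reached⇒linked i be)
                   ◅◅ Branch.reached⇒linked i be′)
    where
    to-D : ∀ {x y} → Branch.Linked i x y → BranchLink i x y
    to-D (r , r′ , x) = r , r′ , crossChord⁻ x

  adjacent-sym : ∀ {i j} → Adjacent i j → Adjacent j i
  adjacent-sym (e , e′ , be , be′ , x) = e′ , e , be′ , be , crossChord-sym D x

  near≢near : ∀ {i j} → j ≢ i → near j ≢ near i
  near≢near j≢i e = j≢i (pairs-disjoint (inj₁ refl) (inj₁ e))

  near≢far′ : ∀ {i j} → j ≢ i → near j ≢ far i
  near≢far′ j≢i e = j≢i (pairs-disjoint (inj₁ refl) (inj₂ e))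

  crossesHub⇒adjacent : ∀ i j (j≢i : j ≢ i) →
                        Branch.CrossesHub′ i (near j) (near≢near j≢i) (near≢far′ j≢i) → Adjacent i j
  crossesHub⇒adjacent i j _ (e , re , x) = e , hub (near j) , re , ε , crossChord⁻ x

  private
    F : Fin t → V
    F i = first (near i)

  -- On the left of x₁ the branch whose hub ends nearer to x₀ reaches past x₁, hence crosses the other hub.
  ¬¬-adjacent-left : (∀ i → p (first (far i)) < p (F i) × p (F i) < p x₁) →
                     ∀ i j (j≢i : j ≢ i) → p (F i) < p (F j) → ¬ ¬ Adjacent i j
  ¬¬-adjacent-left left i j j≢i Fi<Fj ¬adj =
    Branch.¬¬-touched-beyond-x₁ i (proj₁ (left i)) (proj₂ (left i)) λ beyond →
    Branch.¬¬-crossesHub′-from-left i (near j) (near≢near j≢i) (near≢far′ j≢i) Fi<Fj (proj₂ (left j)) beyond λ c →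
    ¬adj (crossesHub⇒adjacent i j j≢i c)

  ¬¬-adjacent-right : (∀ i → p x₁ < p (F i) × p (F i) < p (first (far i))) →
                      ∀ i j (j≢i : j ≢ i) → p (F j) < p (F i) → ¬ ¬ Adjacent i j
  ¬¬-adjacent-right right i j j≢i Fj<Fi ¬adj =
    Branch.¬¬-touched-left-of-x₁ i (proj₁ (right i)) (proj₂ (right i)) λ left-of →
    Branch.¬¬-crossesHub′-from-right i (near j) (near≢near j≢i) (near≢far′ j≢i) Fj<Fi (proj₁ (right j)) left-of λ c →
    ¬adj (crossesHub⇒adjacent i j j≢i c)

  ¬¬-adjacent : ∀ i j → i ≢ j → ¬ ¬ Adjacent i j
  ¬¬-adjacent i j i≢j with one-side | <-cmp (p (F i)) (p (F j))
  ... | _          | tri≈ _ e _ = ⊥-elim (i≢j (pairs-disjoint (inj₁ refl) (inj₁ (first-injective e))))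
  ... | inj₁ left  | tri< l _ _ = ¬¬-adjacent-left left i j (i≢j ∘ ≡.sym) l
  ... | inj₁ left  | tri> _ _ g = λ ¬adj → ¬¬-adjacent-left left j i i≢j g (¬adj ∘ adjacent-sym)
  ... | inj₂ right | tri< l _ _ = λ ¬adj → ¬¬-adjacent-right right j i i≢j l (¬adj ∘ adjacent-sym)
  ... | inj₂ right | tri> _ _ g = ¬¬-adjacent-right right i j (i≢j ∘ ≡.sym) g

  ¬¬-cliqueMinor : ¬ ¬ HasCliqueMinor (Edge G) (Cross D) t
  ¬¬-cliqueMinor ¬minor = ¬¬-∀-Fin t (λ i → ¬¬-∀-Fin t (λ j → ¬¬-adjacent-if-≢ i j)) λ adjacent →
    ¬minor (branch , (λ i → hub (near i) , ε) , branch-disjoint , branch-connected , adjacent)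
    where
    ¬¬-adjacent-if-≢ : ∀ i j → ¬ ¬ (i ≢ j → Adjacent i j)
    ¬¬-adjacent-if-≢ i j k with i Fin.≟ j
    ... | yes i≡j = k λ i≢j → ⊥-elim (i≢j i≡j)
    ... | no i≢j  = ¬¬-adjacent i j i≢j λ adj → k λ _ → adj

theorem4 : (t : ℕ) → t ≥ 1 → (G : Graph) → (D : CircularDrawing G) →
    ¬ HasCliqueMinor (Edge G) (Cross D) t → ¬ ContainsTopK2 G (4 * t)
theorem4 t _ G D ¬minor T =
  CliqueMinor.¬¬-cliqueMinor D T (leftmostRedrawing D (TopMinorK2.x T zero)) ¬minor
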